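{- Let $n\ge 6$. Among all unicyclic graphs with $n$ vertices whose unique cycle has length $4$, $$F(G_{4,1}^{(n)}) > F(G_{4,2}^{(n)}) = F(G_{4,3}^{(n)}) > F(G_{4,1}^{'(n)}),$$ and every such graph not isomorphic to one of these four has F-index less than $F(G_{4,1}^{'(n)})$.
   Context: All graphs are finite and simple. The F-index of a graph $G$ is $F(G)=\sum_{v\in V(G)} d_G(v)^3$. A unicyclic graph is a connected graph with exactly one cycle. Attaching a leaf to a vertex means adding a new vertex adjacent only to it. $G_{4,1}^{(m)}$: the cycle $C_4$ with $m-4$ leaves attached to one cycle vertex. $G_{4,2}^{(n)}$: $C_4$ with $n-5$ leaves attached to a cycle vertex $u$ and one leaf attached to a cycle vertex adjacent to $u$. $G_{4,3}^{(n)}$: $C_4$ with $n-5$ leaves attached to a cycle vertex $u$ and one leaf attached to the cycle vertex at distance $2$ from $u$. $G_{4,1}^{'(n)}$: obtained from $G_{4,1}^{(n-1)}$ by attaching a new leaf to one of its leaves. -}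

module Defs where

open import Data.Nat using (ℕ; zero; suc; _+_; _^_; _≤_; _≡ᵇ_; _≤ᵇ_)
open import Data.Bool using (Bool; true; false; _∧_; _∨_; not; if_then_else_)
open import Data.Bool.Properties using (∨-comm)
open import Data.Fin using (Fin; toℕ; inject₁; fromℕ; _≟_)
import Data.Fin as F
open import Data.Fin.Properties using ()
open import Data.List using (List; map)
open import Data.Nat.ListAction using (sum)
open import Data.List using () renaming (allFin to allFinL)
open import Data.Product using (Σ; ∃; _×_; _,_)
open import Data.Sum using (_⊎_)
open import Function using (Injective)
open import Relation.Nullary using (does; yes; no; ¬_)
open import Relation.Binary.PropositionalEquality using (_≡_; refl; cong₂)

record Graph (n : ℕ) : Set where
  field
    adj    : Fin n → Fin n → Bool
    sym    : ∀ u v → adj u v ≡ adj v u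
    irrefl : ∀ v → adj v v ≡ false
open Graph public

Adj : ∀ {n} → Graph n → Fin n → Fin n → Set
Adj G u v = adj G u v ≡ true

deg : ∀ {n} → Graph n → Fin n → ℕ
deg {n} G v = sum (map (λ u → if adj G v u then 1 else 0) (allFinL n))

Findex : ∀ {n} → Graph n → ℕ
Findex {n} G = sum (map (λ v → deg G v ^ 3) (allFinL n))

data Reach {n} (G : Graph n) : Fin n → Fin n → Set where
  here : ∀ {u} → Reach G u u
  step : ∀ {u v w} → Adj G u v → Reach G v w → Reach G u w

Connected : ∀ {n} → Graph n → Set
Connected G = ∀ u v → Reach G u v

-- A cycle of length suc k (k ≥ 2): distinct vertices f 0, …, f k with
-- f i ~ f (i+1) and f k ~ f 0.
record Cycle {n} (G : Graph n) (k : ℕ) : Set where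
  field
    two≤k   : 2 ≤ k
    vtx     : Fin (suc k) → Fin n
    inj     : Injective _≡_ _≡_ vtx
    path    : ∀ (i : Fin k) → Adj G (vtx (inject₁ i)) (vtx (F.suc i))
    closing : Adj G (vtx (fromℕ k)) (vtx F.zero)
open Cycle public

SamePair : ∀ {n} → Fin n → Fin n → Fin n → Fin n → Set
SamePair u v a b = (u ≡ a × v ≡ b) ⊎ (u ≡ b × v ≡ a)

CycleEdge : ∀ {n} {G : Graph n} {k} → Cycle G k → Fin n → Fin n → Set
CycleEdge {k = k} C u v =
  (∃ λ (i : Fin k) → SamePair u v (vtx C (inject₁ i)) (vtx C (F.suc i)))
  ⊎ SamePair u v (vtx C (fromℕ k)) (vtx C F.zero)

-- two cycles are the same cycle (subgraph) iff they have the same edge set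
SameCycle : ∀ {n} {G : Graph n} {k l} → Cycle G k → Cycle G l → Set
SameCycle {n} C D = ∀ (u v : Fin n) →
  (CycleEdge C u v → CycleEdge D u v) × (CycleEdge D u v → CycleEdge C u v)

-- connected with exactly one cycle, and that cycle has length 4 (= suc 3)
UnicyclicC4 : ∀ {n} → Graph n → Set
UnicyclicC4 G = Connected G ×
  (Σ (Cycle G 3) λ C → ∀ l (D : Cycle G l) → SameCycle C D)

record _≅_ {n} (G H : Graph n) : Set where
  field
    to      : Fin n → Fin n
    from    : Fin n → Fin n
    to∘from : ∀ x → to (from x) ≡ x
    from∘to : ∀ x → from (to x) ≡ x
    pres    : ∀ u v → adj G u v ≡ adj H (to u) (to v)

neq : ∀ {n} → Fin n → Fin n → Bool
neq u v = not (does (u ≟ v))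

neq-sym : ∀ {n} (u v : Fin n) → neq u v ≡ neq v u
neq-sym u v with u ≟ v | v ≟ u
... | yes _ | yes _ = refl
... | no _  | no _  = refl
... | yes p | no q  = Data.Empty.⊥-elim (q (Relation.Binary.PropositionalEquality.sym p))
  where import Data.Empty
... | no p  | yes q = Data.Empty.⊥-elim (p (Relation.Binary.PropositionalEquality.sym q))
  where import Data.Empty

neq-refl : ∀ {n} (v : Fin n) → neq v v ≡ false
neq-refl v with v ≟ v
... | yes _ = refl
... | no p  = Data.Empty.⊥-elim (p refl)
  where import Data.Empty

mkGraph : ∀ n → (ℕ → ℕ → Bool) → Graph n
mkGraph n b = record
  { adj    = λ u v → (b (toℕ u) (toℕ v) ∨ b (toℕ v) (toℕ u)) ∧ neq u v
  ; sym    = λ u v → cong₂ _∧_ (∨-comm (b (toℕ u) (toℕ v)) (b (toℕ v) (toℕ u))) (neq-sym u v)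
  ; irrefl = helper
  }
  where
    import Data.Bool.Properties
    helper : ∀ v → (b (toℕ v) (toℕ v) ∨ b (toℕ v) (toℕ v)) ∧ neq v v ≡ false
    helper v rewrite neq-refl v = Data.Bool.Properties.∧-zeroʳ _

-- Vertices 0,1,2,3 form the cycle 0-1-2-3-0; vertices ≥ 4 are the others.
cyc : ℕ → ℕ → Bool
cyc i j = ((i ≡ᵇ 0) ∧ (j ≡ᵇ 1)) ∨ ((i ≡ᵇ 1) ∧ (j ≡ᵇ 2)) ∨ ((i ≡ᵇ 2) ∧ (j ≡ᵇ 3)) ∨ ((i ≡ᵇ 3) ∧ (j ≡ᵇ 0))

-- G_{4,1}: every vertex ≥ 4 is a leaf at cycle vertex 0
G41 : ∀ n → Graph n
G41 n = mkGraph n (λ i j → cyc i j ∨ ((i ≡ᵇ 0) ∧ (4 ≤ᵇ j)))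

-- G_{4,2}: vertex 4 is a leaf at 1 (adjacent to 0); vertices ≥ 5 are leaves at 0
G42 : ∀ n → Graph n
G42 n = mkGraph n (λ i j → cyc i j ∨ ((i ≡ᵇ 1) ∧ (j ≡ᵇ 4)) ∨ ((i ≡ᵇ 0) ∧ (5 ≤ᵇ j)))

-- G_{4,3}: vertex 4 is a leaf at 2 (opposite to 0); vertices ≥ 5 are leaves at 0
G43 : ∀ n → Graph n
G43 n = mkGraph n (λ i j → cyc i j ∨ ((i ≡ᵇ 2) ∧ (j ≡ᵇ 4)) ∨ ((i ≡ᵇ 0) ∧ (5 ≤ᵇ j)))

-- G'_{4,1}: vertices ≥ 5 are leaves at 0 (this is G_{4,1}^{(n-1)}),
-- and vertex 4 is a new leaf attached to the leaf 5
G41' : ∀ n → Graph n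
G41' n = mkGraph n (λ i j → cyc i j ∨ ((i ≡ᵇ 5) ∧ (j ≡ᵇ 4)) ∨ ((i ≡ᵇ 0) ∧ (5 ≤ᵇ j)))

-- All degrees are positive and, G being unicyclic, they sum to 2n. Let v have maximum degree Δ.
-- If Δ ≤ n − 4, write every degree as 1 + x: the x's sum to at most n, the one at v is the largest,
-- and three more cycle vertices have x ≥ 1, so every other x is at most n − Δ − 1; bounding (1 + x)³
-- linearly in x and x − 1 gives F(G) < (n − 3)³ + n + 27 = F(G′₄,₁).
-- If Δ ≥ n − 3, then v misses at most two other vertices. It lies on the 4-cycle (otherwise it closes a
-- triangle or a second 4-cycle with it), the opposite corner z is one of the missed vertices, and where the
-- other missed vertex w hangs decides whether G is G₄,₁, G₄,₂, G₄,₃ or G′₄,₁. Each isomorphism is obtained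
-- from a bijection under which every edge of the model is an edge of G: as G has no more edges, it is exact.

module Submission where

open import Defs hiding (sym)
open import Data.Bool using (Bool; true; false; if_then_else_; _∧_; _∨_; not)
open import Data.Bool.Properties using (∨-comm; ∧-comm; ∧-identityʳ; ∨-zeroʳ)
import Data.Bool.Properties as Bool
open import Data.Empty using (⊥; ⊥-elim)
open import Data.Fin using (Fin; zero; suc; toℕ; inject₁; inject≤; fromℕ; fromℕ<; punchIn; _≟_)
open import Data.Fin.Patterns using (0F; 1F; 2F; 3F; 4F; 5F)
open import Data.Fin.Permutation using (Permutation; _⟨$⟩ʳ_; _⟨$⟩ˡ_; _∘ₚ_; transpose; inverseˡ; inverseʳ)
import Data.Fin.Permutation as Perm
import Data.Fin.Permutation.Components as PC
open import Data.Fin.Properties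
  using (pigeonhole; any?; all?; toℕ<n; toℕ-injective; toℕ-inject₁; toℕ-fromℕ; toℕ-fromℕ<; toℕ≤pred[n];
         toℕ-inject≤; inject≤-injective; punchIn-injective; punchInᵢ≢i)
import Data.Fin.Properties as Fin
open import Data.List using (List; []; _∷_; map; allFin; tabulate)
open import Data.List.Properties using (map-tabulate)
open import Data.List.Membership.Propositional using (_∈_)
import Data.List.Membership.DecPropositional as DecMembership
open import Data.List.Relation.Unary.All using (All; []; _∷_)
import Data.List.Relation.Unary.All as All
open import Data.Nat using (ℕ; zero; suc; _+_; _*_; _∸_; _^_; _≤_; _<_; _>_; z≤n; s≤s; _≤?_; _≡ᵇ_; _≤ᵇ_)
open import Data.Nat.Properties hiding (_≟_)
open import Algebra.Properties.CommutativeMonoid.Sum +-0-commutativeMonoid using (sum; sum-cong-≗; sum-permute)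
import Data.Nat.ListAction as List
open import Data.Nat.Tactic.RingSolver using (solve-∀)
open import Data.Product using (Σ; ∃; ∃₂; _×_; _,_; proj₁; proj₂)
open import Data.Product.Properties using (≡-dec)
open import Data.Sum using (_⊎_; inj₁; inj₂; [_,_])
open import Data.Vec using ([]; _∷_; lookup)
open import Data.Vec.Relation.Unary.All using ([]; _∷_)
open import Data.Vec.Relation.Unary.AllPairs using ([]; _∷_)
open import Data.Vec.Relation.Unary.Unique.Propositional.Properties using (lookup-injective)
open import Function using (_∘_; id; Injective; case_of_)
open import Relation.Binary using (tri<; tri≈; tri>)
open import Relation.Binary.PropositionalEquality
  using (_≡_; _≢_; refl; sym; trans; cong; cong₂; subst; subst₂; ≢-sym; module ≡-Reasoning)
open import Relation.Nullary using (¬_; Dec; yes; no; does)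
open import Relation.Nullary.Decidable using (True; toWitness; _→-dec_; dec-true; dec-false)

sum-mono-≤ : ∀ {n} {f g : Fin n → ℕ} → (∀ i → f i ≤ g i) → sum f ≤ sum g
sum-mono-≤ {zero}  f≤g = z≤n
sum-mono-≤ {suc n} f≤g = +-mono-≤ (f≤g zero) (sum-mono-≤ (f≤g ∘ suc))

sum-distrib-+ : ∀ {n} (f g : Fin n → ℕ) → sum (λ i → f i + g i) ≡ sum f + sum g
sum-distrib-+ {zero}  f g = refl
sum-distrib-+ {suc n} f g = begin
  f zero + g zero + sum (λ i → f (suc i) + g (suc i))
    ≡⟨ cong (f zero + g zero +_) (sum-distrib-+ (f ∘ suc) (g ∘ suc)) ⟩
  f zero + g zero + (sum (f ∘ suc) + sum (g ∘ suc))
    ≡⟨ +-comm-middle (f zero) (g zero) (sum (f ∘ suc)) (sum (g ∘ suc)) ⟩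
  f zero + sum (f ∘ suc) + (g zero + sum (g ∘ suc)) ∎
  where
  open ≡-Reasoning
  +-comm-middle : ∀ a b c d → a + b + (c + d) ≡ a + c + (b + d)
  +-comm-middle = solve-∀

sum-distribˡ-* : ∀ {n} k (f : Fin n → ℕ) → sum (λ i → k * f i) ≡ k * sum f
sum-distribˡ-* {zero}  k f = sym (*-zeroʳ k)
sum-distribˡ-* {suc n} k f =
  trans (cong (k * f zero +_) (sum-distribˡ-* k (f ∘ suc))) (sym (*-distribˡ-+ k (f zero) _))

sum-const : ∀ {n} c → sum {n} (λ _ → c) ≡ n * c
sum-const {zero}  c = refl
sum-const {suc n} c = cong (c +_) (sum-const {n} c)

sum-ones : ∀ n → sum {n} (λ _ → 1) ≡ n
sum-ones n = trans (sum-const {n} 1) (*-identityʳ n)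

sum-zeros : ∀ {n} {f : Fin n → ℕ} → (∀ i → f i ≡ 0) → sum f ≡ 0
sum-zeros {n} f≡0 = trans (sum-cong-≗ f≡0) (trans (sum-const {n} 0) (*-zeroʳ n))

erase : ∀ {n} → Fin n → (Fin n → ℕ) → Fin n → ℕ
erase p f i = if does (i ≟ p) then 0 else f i

erase-other : ∀ {n} {p i : Fin n} f → i ≢ p → erase p f i ≡ f i
erase-other {p = p} {i} f i≢p with i ≟ p
... | yes i≡p = ⊥-elim (i≢p i≡p)
... | no _ = refl

erase-mono : ∀ {n} (p : Fin n) {f g : Fin n → ℕ} → (∀ i → f i ≤ g i) → ∀ i → erase p f i ≤ erase p g i
erase-mono p f≤g i with i ≟ p
... | yes _ = z≤n
... | no _  = f≤g i

erase-positive : ∀ {n} (p : Fin n) f i → 1 ≤ erase p f i → i ≢ p × 1 ≤ f i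
erase-positive p f i 1≤ with i ≟ p
... | no i≢p = i≢p , 1≤

erase-suc : ∀ {n} (p : Fin n) f i → erase (suc p) f (suc i) ≡ erase p (f ∘ suc) i
erase-suc p f i with i ≟ p
... | yes _ = refl
... | no _ = refl

sum-erase : ∀ {n} (p : Fin n) f → sum f ≡ f p + sum (erase p f)
sum-erase zero    f = refl
sum-erase (suc p) f = begin
  f zero + sum (f ∘ suc)
    ≡⟨ cong (f zero +_) (sum-erase p (f ∘ suc)) ⟩
  f zero + (f (suc p) + sum (erase p (f ∘ suc)))
    ≡⟨ +-exchange (f zero) (f (suc p)) _ ⟩
  f (suc p) + (f zero + sum (erase p (f ∘ suc)))
    ≡⟨ cong (λ s → f (suc p) + (f zero + s)) (sum-cong-≗ (sym ∘ erase-suc p f)) ⟩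
  f (suc p) + sum (erase (suc p) f) ∎
  where
  open ≡-Reasoning
  +-exchange : ∀ a b c → a + (b + c) ≡ b + (a + c)
  +-exchange = solve-∀

sum-suc-at : ∀ {n} (p : Fin n) {f g : Fin n → ℕ} → f p ≡ suc (g p) → (∀ i → i ≢ p → f i ≡ g i) →
             sum f ≡ suc (sum g)
sum-suc-at p {f} {g} fp≡ f≡g = begin
  sum f                      ≡⟨ sum-erase p f ⟩
  f p + sum (erase p f)      ≡⟨ cong₂ _+_ fp≡ (sum-cong-≗ erase-agree) ⟩
  suc (g p + sum (erase p g)) ≡⟨ cong suc (sym (sum-erase p g)) ⟩
  suc (sum g)                ∎
  where
  open ≡-Reasoning
  erase-agree : ∀ i → erase p f i ≡ erase p g i
  erase-agree i with i ≟ p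
  ... | yes _   = refl
  ... | no i≢p = f≡g i i≢p

sum-suc-at₂ : ∀ {n} {p q : Fin n} {f g : Fin n → ℕ} → p ≢ q → f p ≡ suc (g p) → f q ≡ suc (g q) →
              (∀ i → i ≢ p → i ≢ q → f i ≡ g i) → sum f ≡ 2 + sum g
sum-suc-at₂ {p = p} {q} {f} {g} p≢q fp≡ fq≡ f≡g = begin
  sum f                             ≡⟨ sum-erase q f ⟩
  f q + sum (erase q f)             ≡⟨ cong₂ _+_ fq≡ (sum-suc-at p erased-at-p erased-agree) ⟩
  suc (g q) + suc (sum (erase q g)) ≡⟨ cong suc (+-suc (g q) _) ⟩
  2 + (g q + sum (erase q g))       ≡⟨ cong (2 +_) (sum-erase q g) ⟨
  2 + sum g                         ∎
  where
  open ≡-Reasoning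
  erased-at-p : erase q f p ≡ suc (erase q g p)
  erased-at-p = trans (erase-other f p≢q) (trans fp≡ (cong suc (sym (erase-other g p≢q))))
  erased-agree : ∀ i → i ≢ p → erase q f i ≡ erase q g i
  erased-agree i i≢p with i ≟ q
  ... | yes _   = refl
  ... | no i≢q = f≡g i i≢p i≢q

sum-≥-point : ∀ {n} (p : Fin n) f → f p ≤ sum f
sum-≥-point p f = subst (f p ≤_) (sym (sum-erase p f)) (m≤m+n _ _)

sum-≥-pair : ∀ {n} {p q : Fin n} f → q ≢ p → f p + f q ≤ sum f
sum-≥-pair {p = p} {q} f q≢p = subst (f p + f q ≤_) (sym (sum-erase p f))
  (+-monoʳ-≤ (f p) (subst (_≤ sum (erase p f)) (erase-other f q≢p) (sum-≥-point q (erase p f))))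

sum-≥-triple : ∀ {n} {p q r : Fin n} f → q ≢ p → r ≢ p → r ≢ q → f p + f q + f r ≤ sum f
sum-≥-triple {p = p} {q} {r} f q≢p r≢p r≢q = subst (f p + f q + f r ≤_) (sym (sum-erase p f))
  (subst (_≤ f p + sum (erase p f)) (sym (+-assoc (f p) (f q) (f r)))
    (+-monoʳ-≤ (f p) (subst₂ (λ s t → s + t ≤ sum (erase p f)) (erase-other f q≢p) (erase-other f r≢p)
      (sum-≥-pair (erase p f) r≢q))))

sum-positive : ∀ {n} (f : Fin n → ℕ) → 1 ≤ sum f → ∃ λ i → 1 ≤ f i
sum-positive {suc n} f 1≤Σ with f zero in eq
... | suc _ = zero , subst (1 ≤_) (sym eq) (s≤s z≤n)
... | zero  with sum-positive (f ∘ suc) 1≤Σ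
...   | i , 1≤fi = suc i , 1≤fi

sum≡0⇒≡0 : ∀ {n} (f : Fin n → ℕ) → sum f ≡ 0 → ∀ i → f i ≡ 0
sum≡0⇒≡0 f Σ≡0 i = n≤0⇒n≡0 (subst (f i ≤_) Σ≡0 (sum-≥-point i f))

sum≤1⇒support : ∀ {n} (d : Fin n) (f : Fin n → ℕ) → sum f ≤ 1 → ∃ λ w → ∀ i → i ≢ w → f i ≡ 0
sum≤1⇒support d f Σ≤1 with 1 ≤? sum f
... | no  Σ≱1 = d , λ i _ → sum≡0⇒≡0 f (n<1⇒n≡0 (≰⇒> Σ≱1)) i
... | yes 1≤Σ with sum-positive f 1≤Σ
...   | w , 1≤fw = w , λ i i≢w → trans (sym (erase-other f i≢w)) (sum≡0⇒≡0 (erase w f) rest≡0 i)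
  where
  rest≡0 : sum (erase w f) ≡ 0
  rest≡0 = n≤0⇒n≡0 (+-cancelˡ-≤ 1 (sum (erase w f)) 0
             (≤-trans (+-monoˡ-≤ (sum (erase w f)) 1≤fw) (subst (_≤ 1) (sum-erase w f) Σ≤1)))

sum≤2⇒support : ∀ {n} (d : Fin n) (f : Fin n → ℕ) → sum f ≤ 2 →
                ∃₂ λ w₁ w₂ → ∀ i → i ≢ w₁ → i ≢ w₂ → f i ≡ 0
sum≤2⇒support d f Σ≤2 with 1 ≤? sum f
... | no  Σ≱1 = d , d , λ i _ _ → sum≡0⇒≡0 f (n<1⇒n≡0 (≰⇒> Σ≱1)) i
... | yes 1≤Σ with sum-positive f 1≤Σ
...   | w₁ , 1≤fw₁ with sum≤1⇒support d (erase w₁ f) rest≤1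
  where
  rest≤1 : sum (erase w₁ f) ≤ 1
  rest≤1 = +-cancelˡ-≤ 1 (sum (erase w₁ f)) 1
             (≤-trans (+-monoˡ-≤ (sum (erase w₁ f)) 1≤fw₁) (subst (_≤ 2) (sum-erase w₁ f) Σ≤2))
...     | w₂ , rest-support = w₁ , w₂ , λ i i≢w₁ i≢w₂ → trans (sym (erase-other f i≢w₁)) (rest-support i i≢w₂)

sum-≥⇒≗ : ∀ {n} (f g : Fin n → ℕ) → (∀ i → f i ≤ g i) → sum g ≤ sum f → ∀ i → f i ≡ g i
sum-≥⇒≗ {suc n} f g f≤g Σg≤Σf zero = ≤-antisym (f≤g zero)
  (+-cancelʳ-≤ (sum (f ∘ suc)) (g zero) (f zero)
    (≤-trans (+-monoʳ-≤ (g zero) (sum-mono-≤ (f≤g ∘ suc))) Σg≤Σf))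
sum-≥⇒≗ {suc n} f g f≤g Σg≤Σf (suc i) = sum-≥⇒≗ (f ∘ suc) (g ∘ suc) (f≤g ∘ suc)
  (+-cancelˡ-≤ (g zero) (sum (g ∘ suc)) (sum (f ∘ suc))
    (≤-trans Σg≤Σf (+-monoˡ-≤ (sum (f ∘ suc)) (f≤g zero)))) i

argmax : ∀ {n} (f : Fin (suc n) → ℕ) → ∃ λ v → ∀ u → f u ≤ f v
argmax {zero}  f = zero , λ { zero → ≤-refl }
argmax {suc n} f with argmax (f ∘ suc)
... | w , f≤fw with f zero ≤? f (suc w)
...   | yes f0≤fw = suc w , λ { zero → f0≤fw ; (suc u) → f≤fw u }
...   | no  f0≰fw = zero , λ { zero → ≤-refl ; (suc u) → ≤-trans (f≤fw u) (<⇒≤ (≰⇒> f0≰fw)) }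

positive : ℕ → ℕ
positive zero    = 0
positive (suc _) = 1

positive-mono : ∀ {a b} → a ≤ b → positive a ≤ positive b
positive-mono {zero}  _       = z≤n
positive-mono {suc _} (s≤s _) = ≤-refl

positive-≤1 : ∀ a → positive a ≤ 1
positive-≤1 zero    = z≤n
positive-≤1 (suc _) = ≤-refl

ind : Bool → ℕ
ind true  = 1
ind false = 0

ind≥1⇒true : ∀ {b} → 1 ≤ ind b → b ≡ true
ind≥1⇒true {true} _ = refl

ind-injective : ∀ {a b} → ind a ≡ ind b → a ≡ b
ind-injective {true}  {true}  _ = refl
ind-injective {false} {false} _ = refl

ind-mono : ∀ {a b} → (a ≡ true → b ≡ true) → ind a ≤ ind b
ind-mono {true}  a⇒b rewrite a⇒b refl = ≤-refl
ind-mono {false} a⇒b = z≤n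

degree : ∀ {n} → Graph n → Fin n → ℕ
degree G v = sum (λ u → ind (adj G v u))

degreeSum : ∀ {n} → Graph n → ℕ
degreeSum G = sum (degree G)

sum-allFin : ∀ {n} (f : Fin n → ℕ) → List.sum (map f (allFin n)) ≡ sum f
sum-allFin f = trans (cong List.sum (map-tabulate id f)) (sum-tabulate f)
  where
  sum-tabulate : ∀ {n} (f : Fin n → ℕ) → List.sum (tabulate f) ≡ sum f
  sum-tabulate {zero}  f = refl
  sum-tabulate {suc n} f = cong (f zero +_) (sum-tabulate (f ∘ suc))

deg≡degree : ∀ {n} (G : Graph n) v → deg G v ≡ degree G v
deg≡degree G v = trans (sum-allFin (λ u → if adj G v u then 1 else 0)) (sum-cong-≗ λ u → if-ind (adj G v u))
  where
  if-ind : ∀ b → (if b then 1 else 0) ≡ ind b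
  if-ind true  = refl
  if-ind false = refl

Findex≡ : ∀ {n} (G : Graph n) → Findex G ≡ sum (λ v → degree G v ^ 3)
Findex≡ G = trans (sum-allFin (λ v → deg G v ^ 3)) (sum-cong-≗ λ v → cong (_^ 3) (deg≡degree G v))

Adj-sym : ∀ {n} (G : Graph n) {u v} → Adj G u v → Adj G v u
Adj-sym G {u} {v} u~v = trans (Graph.sym G v u) u~v

Adj⇒≢ : ∀ {n} (G : Graph n) {u v} → Adj G u v → u ≢ v
Adj⇒≢ G {u} u~u refl with trans (sym u~u) (irrefl G u)
... | ()

degree-≥1 : ∀ {n} (G : Graph n) {v u} → Adj G v u → 1 ≤ degree G v
degree-≥1 G {v} {u} v~u = subst (_≤ degree G v) (cong ind v~u) (sum-≥-point u (λ w → ind (adj G v w)))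

degree-≥2 : ∀ {n} (G : Graph n) {v u w} → Adj G v u → Adj G v w → w ≢ u → 2 ≤ degree G v
degree-≥2 G {v} v~u v~w w≢u =
  subst (_≤ degree G v) (cong₂ _+_ (cong ind v~u) (cong ind v~w)) (sum-≥-pair (λ x → ind (adj G v x)) w≢u)

degree-≥1⇒neighbour : ∀ {n} (G : Graph n) {x} → 1 ≤ degree G x → ∃ λ y → Adj G x y
degree-≥1⇒neighbour G {x} 1≤deg with sum-positive (λ y → ind (adj G x y)) 1≤deg
... | y , 1≤ = y , ind≥1⇒true 1≤

neighbour : ∀ {n} {G : Graph n} {u x} → Reach G u x → u ≢ x → ∃ λ y → Adj G u y
neighbour here          u≢u = ⊥-elim (u≢u refl)
neighbour (step u~y _)  _   = _ , u~y

record Square {n} (G : Graph n) (a b c d : Fin n) : Set where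
  field
    a≢b : a ≢ b
    a≢c : a ≢ c
    a≢d : a ≢ d
    b≢c : b ≢ c
    b≢d : b ≢ d
    c≢d : c ≢ d
    a~b : Adj G a b
    b~c : Adj G b c
    c~d : Adj G c d
    d~a : Adj G d a

Square-rotate : ∀ {n} {G : Graph n} {a b c d} → Square G a b c d → Square G b c d a
Square-rotate s = record
  { a≢b = b≢c ; a≢c = b≢d ; a≢d = ≢-sym a≢b ; b≢c = c≢d ; b≢d = ≢-sym a≢c ; c≢d = ≢-sym a≢d
  ; a~b = b~c ; b~c = c~d ; c~d = d~a ; d~a = a~b }
  where open Square s

Square-reflect : ∀ {n} {G : Graph n} {a b c d} → Square G a b c d → Square G a d c b
Square-reflect {G = G} s = record
  { a≢b = a≢d ; a≢c = a≢c ; a≢d = a≢b ; b≢c = ≢-sym c≢d ; b≢d = ≢-sym b≢d ; c≢d = ≢-sym b≢c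
  ; a~b = Adj-sym G d~a ; b~c = Adj-sym G c~d ; c~d = Adj-sym G b~c ; d~a = Adj-sym G a~b }
  where open Square s

triangle-cycle : ∀ {n} (G : Graph n) {a b c} → a ≢ b → a ≢ c → b ≢ c →
                 Adj G a b → Adj G b c → Adj G c a → Cycle G 2
triangle-cycle G {a} {b} {c} a≢b a≢c b≢c a~b b~c c~a = record
  { two≤k = s≤s (s≤s z≤n)
  ; vtx = lookup (a ∷ b ∷ c ∷ [])
  ; inj = λ {i} {j} → lookup-injective ((a≢b ∷ a≢c ∷ []) ∷ (b≢c ∷ []) ∷ [] ∷ []) i j
  ; path = λ { zero → a~b ; (suc zero) → b~c }
  ; closing = c~a }

square-cycle : ∀ {n} (G : Graph n) {a b c d} → Square G a b c d → Cycle G 3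
square-cycle G {a} {b} {c} {d} s = record
  { two≤k = s≤s (s≤s z≤n)
  ; vtx = lookup (a ∷ b ∷ c ∷ d ∷ [])
  ; inj = λ {i} {j} → lookup-injective
      ((a≢b ∷ a≢c ∷ a≢d ∷ []) ∷ (b≢c ∷ b≢d ∷ []) ∷ (c≢d ∷ []) ∷ [] ∷ []) i j
  ; path = λ { zero → a~b ; (suc zero) → b~c ; (suc (suc zero)) → c~d }
  ; closing = d~a }
  where open Square s

fromℕ⊎inject₁ : ∀ {l} (i : Fin (suc l)) → i ≡ fromℕ l ⊎ ∃ λ i′ → i ≡ inject₁ i′
fromℕ⊎inject₁ {zero}  zero    = inj₁ refl
fromℕ⊎inject₁ {suc l} zero    = inj₂ (zero , refl)
fromℕ⊎inject₁ {suc l} (suc i) with fromℕ⊎inject₁ i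
... | inj₁ i≡last      = inj₁ (cong suc i≡last)
... | inj₂ (i′ , i≡i′) = inj₂ (suc i′ , cong suc i≡i′)

Cycle-weaken : ∀ {n} {H G : Graph n} → (∀ {x y} → Adj H x y → Adj G x y) → ∀ {l} → Cycle H l → Cycle G l
Cycle-weaken H⊆G D = record
  { two≤k = two≤k D ; vtx = vtx D ; inj = inj D ; path = H⊆G ∘ path D ; closing = H⊆G (closing D) }

module _ {n} {G : Graph n} where

  CycleEdge-Adj : ∀ {l} (D : Cycle G l) {x y} → CycleEdge D x y → Adj G x y
  CycleEdge-Adj D (inj₁ (i , inj₁ (refl , refl))) = path D i
  CycleEdge-Adj D (inj₁ (i , inj₂ (refl , refl))) = Adj-sym G (path D i)
  CycleEdge-Adj D (inj₂ (inj₁ (refl , refl)))     = closing D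
  CycleEdge-Adj D (inj₂ (inj₂ (refl , refl)))     = Adj-sym G (closing D)

  CycleEdge-onCycle : ∀ {l} (D : Cycle G l) {x y} → CycleEdge D x y → ∃ λ i → x ≡ vtx D i
  CycleEdge-onCycle D (inj₁ (i , inj₁ (x≡ , _))) = inject₁ i , x≡
  CycleEdge-onCycle D (inj₁ (i , inj₂ (x≡ , _))) = suc i , x≡
  CycleEdge-onCycle {l} D (inj₂ (inj₁ (x≡ , _))) = fromℕ l , x≡
  CycleEdge-onCycle D (inj₂ (inj₂ (x≡ , _)))     = zero , x≡

  onCycle-CycleEdge : ∀ {l} (D : Cycle G l) i → ∃ λ y → CycleEdge D (vtx D i) y
  onCycle-CycleEdge {l} D i with fromℕ⊎inject₁ i
  ... | inj₁ i≡last     = vtx D zero , inj₂ (inj₁ (cong (vtx D) i≡last , refl))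
  ... | inj₂ (i′ , i≡i′) = vtx D (suc i′) , inj₁ (i′ , inj₁ (cong (vtx D) i≡i′ , refl))

module UnicyclicC4Facts {n} {G : Graph n} (U : UnicyclicC4 G) where

  C : Cycle G 3
  C = proj₁ (proj₂ U)

  c : Fin 4 → Fin n
  c = vtx C

  C-square : Square G (c 0F) (c 1F) (c 2F) (c 3F)
  C-square = record
    { a≢b = λ e → case inj C e of λ () ; a≢c = λ e → case inj C e of λ () ; a≢d = λ e → case inj C e of λ ()
    ; b≢c = λ e → case inj C e of λ () ; b≢d = λ e → case inj C e of λ () ; c≢d = λ e → case inj C e of λ ()
    ; a~b = path C zero ; b~c = path C (suc zero) ; c~d = path C (suc (suc zero)) ; d~a = closing C }

  C⊆ : ∀ {l} (D : Cycle G l) j → ∃ λ i → c j ≡ vtx D i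
  C⊆ {l} D j with onCycle-CycleEdge C j
  ... | y , edge = CycleEdge-onCycle D (proj₁ (proj₂ (proj₂ U) l D (c j) y) edge)

  ⊆C : ∀ {l} (D : Cycle G l) i → ∃ λ j → vtx D i ≡ c j
  ⊆C {l} D i with onCycle-CycleEdge D i
  ... | y , edge = CycleEdge-onCycle C (proj₂ (proj₂ (proj₂ U) l D (vtx D i) y) edge)

  -- the four vertices of C would have to fit on the three vertices of the triangle
  no-triangle : ∀ {a b d} → a ≢ b → a ≢ d → b ≢ d → Adj G a b → Adj G b d → Adj G d a → ⊥
  no-triangle a≢b a≢d b≢d a~b b~d d~a =
    let i , j , i<j , same = pigeonhole (s≤s (s≤s (s≤s (s≤s z≤n)))) (λ j → proj₁ (C⊆ D j))
    in Fin.<⇒≢ i<j (inj C (trans (proj₂ (C⊆ D i)) (trans (cong (vtx D) same) (sym (proj₂ (C⊆ D j))))))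
    where
    D : Cycle G 2
    D = triangle-cycle G a≢b a≢d b≢d a~b b~d d~a

  square-onC : ∀ {a b d e} → Square G a b d e → ∃ λ j → a ≡ c j
  square-onC s = ⊆C (square-cycle G s) zero

-- Acyclic graphs with an edge have a leaf

least : ∀ {P : ℕ → Set} → (∀ k → Dec (P k)) → ∀ {k} → P k → ∃ λ j → P j × (∀ i → i < j → ¬ P i)
least {P} P? {k} pk with search (suc k)
  where
  search : ∀ k → (∀ i → i < k → ¬ P i) ⊎ (∃ λ j → P j × (∀ i → i < j → ¬ P i))
  search zero = inj₁ λ _ ()
  search (suc k) with search k
  ... | inj₂ found = inj₂ found
  ... | inj₁ none with P? k
  ...   | yes pk = inj₂ (k , pk , none)
  ...   | no ¬pk = inj₁ λ i i<1+k → [ none i , (λ { refl → ¬pk }) ] (m<1+n⇒m<n∨m≡n i<1+k)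
... | inj₂ found = found
... | inj₁ none  = ⊥-elim (none k ≤-refl pk)

Acyclic : ∀ {n} → Graph n → Set
Acyclic H = ∀ l → Cycle H l → ⊥

-- the segment of the walk between the first repeated vertex and its earlier visit is a cycle
module NonBacktrackingWalk {n} (G : Graph n) (w : ℕ → Fin n)
  (w~ : ∀ k → Adj G (w k) (w (suc k))) (no-backtrack : ∀ k → w (suc (suc k)) ≢ w k) where

  Revisit : ℕ → Set
  Revisit j = ∃ λ (i : Fin j) → w (toℕ i) ≡ w j

  opaque
    first-revisit : ∃ λ j → Revisit j × (∀ j′ → j′ < j → ¬ Revisit j′)
    first-revisit with pigeonhole (n<1+n n) (λ t → w (toℕ t))
    ... | i , j , i<j , same = least (λ j → any? λ i → w (toℕ i) ≟ w j)
                                      {toℕ j} (fromℕ< i<j , trans (cong w (toℕ-fromℕ< i<j)) same)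

  J I : ℕ
  J = proj₁ first-revisit
  I = toℕ (proj₁ (proj₁ (proj₂ first-revisit)))

  I<J : I < J
  I<J = toℕ<n _

  wI≡wJ : w I ≡ w J
  wI≡wJ = proj₂ (proj₁ (proj₂ first-revisit))

  distinct : ∀ a b → a < b → b < J → w a ≢ w b
  distinct a b a<b b<J wa≡wb =
    proj₂ (proj₂ first-revisit) b b<J (fromℕ< a<b , trans (cong w (toℕ-fromℕ< a<b)) wa≡wb)

  D : ℕ
  D = proj₁ (m≤n⇒∃[o]m+o≡n I<J)

  I+1+D≡J : I + suc D ≡ J
  I+1+D≡J = trans (+-suc I D) (proj₂ (m≤n⇒∃[o]m+o≡n I<J))

  2≤D : 2 ≤ D
  2≤D = gap≥2 I+1+D≡J
    where
    gap≥2 : ∀ {d} → I + suc d ≡ J → 2 ≤ d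
    gap≥2 {zero}        e = ⊥-elim (Adj⇒≢ G (w~ I) (trans wI≡wJ (cong w (trans (sym e) (+-comm I 1)))))
    gap≥2 {suc zero}    e = ⊥-elim (no-backtrack I (trans (cong w (trans (+-comm 2 I) e)) (sym wI≡wJ)))
    gap≥2 {suc (suc _)} _ = s≤s (s≤s z≤n)

  segment : Fin (suc D) → Fin n
  segment t = w (I + toℕ t)

  segment-inside : ∀ (t : Fin (suc D)) → I + toℕ t < J
  segment-inside t = subst (I + toℕ t <_) I+1+D≡J (+-monoʳ-< I (s≤s (toℕ≤pred[n] t)))

  segment-injective : ∀ {s t} → segment s ≡ segment t → s ≡ t
  segment-injective {s} {t} e with <-cmp (toℕ s) (toℕ t)
  ... | tri< s<t _ _ = ⊥-elim (distinct _ _ (+-monoʳ-< I s<t) (segment-inside t) e)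
  ... | tri≈ _ s≡t _ = toℕ-injective s≡t
  ... | tri> _ _ t<s = ⊥-elim (distinct _ _ (+-monoʳ-< I t<s) (segment-inside s) (sym e))

  cycle : Cycle G D
  cycle = record
    { two≤k = 2≤D
    ; vtx = segment
    ; inj = segment-injective
    ; path = λ t → subst₂ (λ x y → Adj G (w x) (w y))
        (cong (I +_) (sym (toℕ-inject₁ t))) (sym (+-suc I (toℕ t))) (w~ (I + toℕ t))
    ; closing = subst₂ (λ x y → Adj G (w x) y) (cong (I +_) (sym (toℕ-fromℕ D)))
        (trans (cong w (trans (sym (+-suc I D)) I+1+D≡J)) (trans (sym wI≡wJ) (cong w (sym (+-identityʳ I)))))
        (w~ (I + D))
    }

other-neighbour : ∀ {n} (H : Graph n) {p x} → Adj H x p → 2 ≤ degree H x → ∃ λ y → Adj H x y × y ≢ p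
other-neighbour H {p} {x} x~p 2≤deg with sum-positive (erase p row) 1≤rest
  where
  row : Fin _ → ℕ
  row y = ind (adj H x y)
  1≤rest : 1 ≤ sum (erase p row)
  1≤rest = +-cancelˡ-≤ 1 1 _ (subst (2 ≤_) (trans (sum-erase p row) (cong (_+ sum (erase p row)) (cong ind x~p))) 2≤deg)
... | y , 1≤ with erase-positive p (λ y → ind (adj H x y)) y 1≤
...   | y≢p , 1≤row = y , ind≥1⇒true 1≤row , y≢p

-- without leaves, a walk that never turns back can be continued forever, and it closes a cycle
module _ {n} (H : Graph n) (no-leaf : ∀ x → degree H x ≢ 1) where

  continue : ∀ {p x} → Adj H p x → ∃ λ y → Adj H x y × y ≢ p
  continue {p} {x} p~x = other-neighbour H (Adj-sym H p~x) (≥1∧≢1⇒≥2 (degree-≥1 H (Adj-sym H p~x)) (no-leaf x))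
    where
    ≥1∧≢1⇒≥2 : ∀ {d} → 1 ≤ d → d ≢ 1 → 2 ≤ d
    ≥1∧≢1⇒≥2 {suc zero}    _ d≢1 = ⊥-elim (d≢1 refl)
    ≥1∧≢1⇒≥2 {suc (suc _)} _ _   = s≤s (s≤s z≤n)

  DirectedEdge : Set
  DirectedEdge = Σ (Fin n × Fin n) λ (p , x) → Adj H p x

  advance : DirectedEdge → DirectedEdge
  advance ((p , x) , p~x) = (x , proj₁ (continue p~x)) , proj₁ (proj₂ (continue p~x))

  walk : DirectedEdge → ℕ → DirectedEdge
  walk e zero    = e
  walk e (suc k) = advance (walk e k)

  edge⇒cycle : ∀ {x y} → Adj H x y → ∃ λ l → Cycle H l
  edge⇒cycle x~y = _ , NonBacktrackingWalk.cycle H head head~ no-backtrack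
    where
    head : ℕ → Fin n
    head k = proj₂ (proj₁ (walk (_ , x~y) k))
    head~ : ∀ k → Adj H (head k) (head (suc k))
    head~ k = proj₂ (walk (_ , x~y) (suc k))
    no-backtrack : ∀ k → head (suc (suc k)) ≢ head k
    no-backtrack k = proj₂ (proj₂ (continue (proj₂ (walk (_ , x~y) (suc k)))))

acyclic⇒leaf : ∀ {n} (H : Graph n) → Acyclic H → 1 ≤ degreeSum H → ∃₂ λ u w → degree H u ≡ 1 × Adj H u w
acyclic⇒leaf H acyclic 1≤Σ with any? (λ u → degree H u Data.Nat.≟ 1)
... | yes (u , deg≡1) with degree-≥1⇒neighbour H (subst (1 ≤_) (sym deg≡1) ≤-refl)
...   | w , u~w = u , w , deg≡1 , u~w
acyclic⇒leaf H acyclic 1≤Σ | no no-leaf with sum-positive (degree H) 1≤Σ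
... | x , 1≤deg = ⊥-elim (acyclic _ (proj₂ (edge⇒cycle H (λ u deg≡1 → no-leaf (u , deg≡1))
                                                  (proj₂ (degree-≥1⇒neighbour H 1≤deg)))))

-- A unicyclic graph has as many edges as vertices

isPair : ∀ {n} → Fin n → Fin n → Fin n → Fin n → Bool
isPair u w x y = (does (x ≟ u) ∧ does (y ≟ w)) ∨ (does (x ≟ w) ∧ does (y ≟ u))

isPair-sym : ∀ {n} (u w x y : Fin n) → isPair u w x y ≡ isPair u w y x
isPair-sym u w x y = trans (∨-comm (does (x ≟ u) ∧ does (y ≟ w)) _)
  (cong₂ _∨_ (∧-comm (does (x ≟ w)) _) (∧-comm (does (x ≟ u)) _))

removeEdge : ∀ {n} → Graph n → Fin n → Fin n → Graph n
removeEdge H u w = record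
  { adj    = λ x y → adj H x y ∧ not (isPair u w x y)
  ; sym    = λ x y → cong₂ _∧_ (Graph.sym H x y) (cong not (isPair-sym u w x y))
  ; irrefl = λ x → cong (_∧ not (isPair u w x x)) (irrefl H x) }

module _ {n} (H : Graph n) (u w : Fin n) where

  removeEdge-⊆ : ∀ {x y} → Adj (removeEdge H u w) x y → Adj H x y
  removeEdge-⊆ {x} {y} x~y with adj H x y
  ... | true = refl

  removeEdge-removes : ¬ Adj (removeEdge H u w) u w
  removeEdge-removes u~w rewrite dec-true (u ≟ u) refl | dec-true (w ≟ w) refl
    with adj H u w
  removeEdge-removes () | true
  removeEdge-removes () | false

  degree-removeEdge-other : ∀ x → x ≢ u → x ≢ w → degree (removeEdge H u w) x ≡ degree H x
  degree-removeEdge-other x x≢u x≢w = sum-cong-≗ λ y →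
    cong ind (trans (cong (λ b → adj H x y ∧ not b)
                      (cong₂ _∨_ (cong (_∧ does (y ≟ w)) (dec-false (x ≟ u) x≢u))
                                 (cong (_∧ does (y ≟ u)) (dec-false (x ≟ w) x≢w))))
                    (∧-identityʳ (adj H x y)))

  degree-removeEdge-u : u ≢ w → Adj H u w → degree H u ≡ suc (degree (removeEdge H u w) u)
  degree-removeEdge-u u≢w u~w = sum-suc-at w at-w elsewhere
    where
    at-w : ind (adj H u w) ≡ suc (ind (adj H u w ∧ not (isPair u w u w)))
    at-w rewrite u~w | dec-true (u ≟ u) refl | dec-true (w ≟ w) refl = refl
    elsewhere : ∀ y → y ≢ w → ind (adj H u y) ≡ ind (adj H u y ∧ not (isPair u w u y))
    elsewhere y y≢w rewrite dec-true (u ≟ u) refl | dec-false (y ≟ w) y≢w | dec-false (u ≟ w) u≢w =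
      cong ind (sym (∧-identityʳ (adj H u y)))

degree-removeEdge-swap : ∀ {n} (H : Graph n) u w x → degree (removeEdge H u w) x ≡ degree (removeEdge H w u) x
degree-removeEdge-swap H u w x = sum-cong-≗ λ y →
  cong (λ b → ind (adj H x y ∧ not b)) (∨-comm (does (x ≟ u) ∧ does (y ≟ w)) _)

degree-removeEdge-w : ∀ {n} (H : Graph n) {u w} → u ≢ w → Adj H u w →
                      degree H w ≡ suc (degree (removeEdge H u w) w)
degree-removeEdge-w H {u} {w} u≢w u~w = trans (degree-removeEdge-u H w u (≢-sym u≢w) (Adj-sym H u~w))
  (cong suc (degree-removeEdge-swap H w u w))

degreeSum-removeEdge : ∀ {n} (H : Graph n) {u w} → u ≢ w → Adj H u w →
                       degreeSum H ≡ 2 + degreeSum (removeEdge H u w)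
degreeSum-removeEdge H {u} {w} u≢w u~w = sum-suc-at₂ u≢w
  (degree-removeEdge-u H u w u≢w u~w) (degree-removeEdge-w H u≢w u~w)
  (λ x x≢u x≢w → sym (degree-removeEdge-other H u w x x≢u x≢w))

degree-removeEdge-≤ : ∀ {n} (H : Graph n) u w x → degree (removeEdge H u w) x ≤ degree H x
degree-removeEdge-≤ H u w x = sum-mono-≤ λ y → ind-mono (removeEdge-⊆ H u w {x} {y})

nonIsolated : ∀ {n} → Graph n → ℕ
nonIsolated H = sum (λ x → positive (degree H x))

nonIsolated≤n : ∀ {n} (H : Graph n) → nonIsolated H ≤ n
nonIsolated≤n {n} H = subst (nonIsolated H ≤_) (sum-ones n) (sum-mono-≤ λ x → positive-≤1 (degree H x))

nonIsolated-≥2 : ∀ {n} (H : Graph n) {u w} → Adj H u w → 2 ≤ nonIsolated H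
nonIsolated-≥2 H {u} {w} u~w = subst (_≤ nonIsolated H)
  (cong₂ _+_ (positive-deg (degree-≥1 H u~w)) (positive-deg (degree-≥1 H (Adj-sym H u~w))))
  (sum-≥-pair (λ x → positive (degree H x)) (≢-sym (Adj⇒≢ H u~w)))
  where
  positive-deg : ∀ {d} → 1 ≤ d → positive d ≡ 1
  positive-deg (s≤s _) = refl

nonIsolated-removeLeaf : ∀ {n} (H : Graph n) {u w} → Adj H u w → degree H u ≡ 1 →
                         suc (nonIsolated (removeEdge H u w)) ≤ nonIsolated H
nonIsolated-removeLeaf H {u} {w} u~w deg≡1 = begin
  suc (sum f′)               ≡⟨ cong suc (sum-erase u f′) ⟩
  suc (f′ u + sum (erase u f′)) ≡⟨ cong (λ d → suc (positive d + sum (erase u f′))) deg′≡0 ⟩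
  suc (sum (erase u f′))     ≤⟨ s≤s (sum-mono-≤ (erase-mono u λ x → positive-mono (degree-removeEdge-≤ H u w x))) ⟩
  suc (sum (erase u f))      ≡⟨ cong (λ d → positive d + sum (erase u f)) (sym deg≡1) ⟩
  f u + sum (erase u f)      ≡⟨ sum-erase u f ⟨
  sum f                      ∎
  where
  open ≤-Reasoning
  f f′ : Fin _ → ℕ
  f  x = positive (degree H x)
  f′ x = positive (degree (removeEdge H u w) x)
  deg′≡0 : degree (removeEdge H u w) u ≡ 0
  deg′≡0 = suc-injective (trans (sym (degree-removeEdge-u H u w (Adj⇒≢ H u~w) u~w)) deg≡1)

forest-bound : ∀ {n} (H : Graph n) → Acyclic H → degreeSum H ≡ 0 ⊎ degreeSum H + 2 ≤ 2 * nonIsolated H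
forest-bound H = bound (degreeSum H) H ≤-refl
  where
  bound : ∀ {n} k (H : Graph n) → degreeSum H ≤ k → Acyclic H →
          degreeSum H ≡ 0 ⊎ degreeSum H + 2 ≤ 2 * nonIsolated H
  bound k H Σ≤k acyclic with degreeSum H in Σ≡
  ... | zero = inj₁ refl
  bound zero H () acyclic | suc _
  bound (suc k) H Σ≤k acyclic | suc _ with acyclic⇒leaf H acyclic (subst (1 ≤_) (sym Σ≡) (s≤s z≤n))
  ... | u , w , deg≡1 , u~w = inj₂ (subst (λ s → s + 2 ≤ 2 * nonIsolated H) (trans (sym Σ-split) Σ≡) Σ+2≤)
    where
    H′ : Graph _
    H′ = removeEdge H u w
    Σ-split : degreeSum H ≡ 2 + degreeSum H′
    Σ-split = degreeSum-removeEdge H (Adj⇒≢ H u~w) u~w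
    Σ′≤k : degreeSum H′ ≤ k
    Σ′≤k = ≤-pred (≤-trans (n≤1+n _) (subst (_≤ suc k) (trans (sym Σ≡) Σ-split) Σ≤k))
    acyclic′ : Acyclic H′
    acyclic′ l D = acyclic l (Cycle-weaken (removeEdge-⊆ H u w) D)
    Σ+2≤ : 2 + degreeSum H′ + 2 ≤ 2 * nonIsolated H
    Σ+2≤ with bound k H′ Σ′≤k acyclic′
    ... | inj₁ Σ′≡0 = subst (λ s → 2 + s + 2 ≤ 2 * nonIsolated H) (sym Σ′≡0)
                        (*-monoʳ-≤ 2 (nonIsolated-≥2 H u~w))
    ... | inj₂ Σ′+2≤ = begin
      2 + degreeSum H′ + 2        ≡⟨ cong (_+ 2) (+-comm 2 (degreeSum H′)) ⟩
      degreeSum H′ + 2 + 2        ≤⟨ +-monoˡ-≤ 2 Σ′+2≤ ⟩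
      2 * nonIsolated H′ + 2      ≡⟨ +-comm (2 * nonIsolated H′) 2 ⟩
      2 + 2 * nonIsolated H′      ≡⟨ *-suc 2 (nonIsolated H′) ⟨
      2 * suc (nonIsolated H′)    ≤⟨ *-monoʳ-≤ 2 (nonIsolated-removeLeaf H u~w deg≡1) ⟩
      2 * nonIsolated H           ∎
      where open ≤-Reasoning

degreeSum≤2n : ∀ {n} (G : Graph n) → UnicyclicC4 G → degreeSum G ≤ 2 * n
degreeSum≤2n {n} G U = [ from-empty , from-forest ] (forest-bound H acyclic)
  where
  open UnicyclicC4Facts U
  open Square C-square
  H : Graph n
  H = removeEdge G (c 0F) (c 1F)
  -- a cycle avoiding the edge c₀c₁ would be a cycle of G with a different edge set from C
  acyclic : Acyclic H
  acyclic l D = removeEdge-removes G (c 0F) (c 1F) (CycleEdge-Adj D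
    (proj₁ (proj₂ (proj₂ U) l (Cycle-weaken (removeEdge-⊆ G _ _) D) (c 0F) (c 1F)) (inj₁ (zero , inj₁ (refl , refl)))))
  Σ-split : degreeSum G ≡ 2 + degreeSum H
  Σ-split = degreeSum-removeEdge G a≢b a~b
  1≤n : 1 ≤ n
  1≤n with c 0F
  ... | zero  = s≤s z≤n
  ... | suc _ = s≤s z≤n
  from-empty : degreeSum H ≡ 0 → degreeSum G ≤ 2 * n
  from-empty Σ≡0 = subst (_≤ 2 * n) (sym (trans Σ-split (cong (2 +_) Σ≡0))) (*-monoʳ-≤ 2 1≤n)
  from-forest : degreeSum H + 2 ≤ 2 * nonIsolated H → degreeSum G ≤ 2 * n
  from-forest Σ+2≤ = begin
    degreeSum G        ≡⟨ Σ-split ⟩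
    2 + degreeSum H    ≡⟨ +-comm 2 (degreeSum H) ⟩
    degreeSum H + 2    ≤⟨ Σ+2≤ ⟩
    2 * nonIsolated H  ≤⟨ *-monoʳ-≤ 2 (nonIsolated≤n H) ⟩
    2 * n              ∎
    where open ≤-Reasoning

-- Recognising a graph through a bijection

transpose-here : ∀ {n} (i j : Fin n) → PC.transpose i j i ≡ j
transpose-here i j rewrite dec-true (i ≟ i) refl = refl

transpose-other : ∀ {n} {i j k : Fin n} → k ≢ i → k ≢ j → PC.transpose i j k ≡ k
transpose-other {i = i} {j} {k} k≢i k≢j rewrite dec-false (k ≟ i) k≢i | dec-false (k ≟ j) k≢j = refl

⟨$⟩ʳ-injective : ∀ {n} (π : Permutation n n) → Injective _≡_ _≡_ (π ⟨$⟩ʳ_)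
⟨$⟩ʳ-injective π {x} {y} πx≡πy = trans (sym (inverseˡ π)) (trans (cong (π ⟨$⟩ˡ_) πx≡πy) (inverseˡ π))

extendToPermutation : ∀ {k n} (f g : Fin k → Fin n) → Injective _≡_ _≡_ f → Injective _≡_ _≡_ g →
                      ∃ λ (π : Permutation n n) → ∀ i → π ⟨$⟩ʳ f i ≡ g i
extendToPermutation {zero}  f g _ _ = Perm.id , λ ()
extendToPermutation {suc k} f g f-inj g-inj
  with extendToPermutation (f ∘ suc) (g ∘ suc) (Fin.suc-injective ∘ f-inj) (Fin.suc-injective ∘ g-inj)
... | π , π-extends = π ∘ₚ transpose (π ⟨$⟩ʳ f zero) (g zero) , extends
  where
  extends : ∀ i → PC.transpose (π ⟨$⟩ʳ f zero) (g zero) (π ⟨$⟩ʳ f i) ≡ g i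
  extends zero    = transpose-here (π ⟨$⟩ʳ f zero) (g zero)
  extends (suc i) = trans (cong (PC.transpose _ _) (π-extends i)) (transpose-other
    (λ gi≡πf0 → Fin.0≢1+n (f-inj (⟨$⟩ʳ-injective π (trans (sym gi≡πf0) (sym (π-extends i))))))
    (λ gi≡g0 → Fin.0≢1+n (g-inj (sym gi≡g0))))

-- Every pulled-back edge of H is an edge of G and G has no more edges, so first the rows and then the cells agree.
≅-fromEmbedding : ∀ {n} (G H : Graph n) (π : Permutation n n) →
                  (∀ x y → Adj H (π ⟨$⟩ʳ x) (π ⟨$⟩ʳ y) → Adj G x y) → degreeSum G ≤ degreeSum H → G ≅ H
≅-fromEmbedding G H π embeds ΣG≤ΣH = record
  { to = π ⟨$⟩ʳ_ ; from = π ⟨$⟩ˡ_ ; to∘from = λ _ → inverseʳ π ; from∘to = λ _ → inverseˡ π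
  ; pres = λ x y → sym (cells-agree x y) }
  where
  pulled : Fin _ → Fin _ → ℕ
  pulled x y = ind (adj H (π ⟨$⟩ʳ x) (π ⟨$⟩ʳ y))
  pulled≤ : ∀ x y → pulled x y ≤ ind (adj G x y)
  pulled≤ x y = ind-mono (embeds x y)
  total : sum (λ x → sum (pulled x)) ≡ degreeSum H
  total = trans (sum-cong-≗ λ x → sym (sum-permute (λ y → ind (adj H (π ⟨$⟩ʳ x) y)) π))
                (sym (sum-permute (degree H) π))
  rows-agree : ∀ x → sum (pulled x) ≡ degree G x
  rows-agree = sum-≥⇒≗ (λ x → sum (pulled x)) (degree G) (λ x → sum-mono-≤ (pulled≤ x))
                       (≤-trans ΣG≤ΣH (≤-reflexive (sym total)))
  cells-agree : ∀ x y → adj H (π ⟨$⟩ʳ x) (π ⟨$⟩ʳ y) ≡ adj G x y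
  cells-agree x y = ind-injective (sum-≥⇒≗ (pulled x) (λ y → ind (adj G x y)) (pulled≤ x)
                                           (≤-reflexive (sym (rows-agree x))) y)

∨-trueˡ : ∀ {a c} → a ≡ true → a ∨ c ≡ true
∨-trueˡ refl = refl

∨-trueʳ : ∀ a {c} → c ≡ true → a ∨ c ≡ true
∨-trueʳ a refl = ∨-zeroʳ a

mkGraph-Adj : ∀ {n} (b : ℕ → ℕ → Bool) {p q : Fin n} → Adj (mkGraph n b) p q →
              b (toℕ p) (toℕ q) ≡ true ⊎ b (toℕ q) (toℕ p) ≡ true
mkGraph-Adj b {p} {q} p~q with b (toℕ p) (toℕ q) | b (toℕ q) (toℕ p)
... | true  | _    = inj₁ refl
... | false | true = inj₂ refl
mkGraph-Adj b {p} {q} () | false | false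

-- The vertices 0, …, k of mkGraph n b are named and sent to chosen vertices s 0, …, s k of G; every other vertex
-- of mkGraph n b may only be adjacent to 0, and is sent to a vertex adjacent to s 0.
module Recognition {n k : ℕ} (k<n : k < n) (b : ℕ → ℕ → Bool)
  (edges : List (Fin (suc k) × Fin (suc k)))
  (named-edges : ∀ (i j : Fin (suc k)) → b (toℕ i) (toℕ j) ≡ true → (i , j) ∈ edges)
  (hub-edges : ∀ (i : Fin (suc k)) (t : ℕ) → b (toℕ i) (suc k + t) ∨ b (suc k + t) (toℕ i) ≡ true → i ≡ zero)
  (no-leaf-edges : ∀ (s t : ℕ) → b (suc k + s) (suc k + t) ≢ true) where

  name : Fin (suc k) → Fin n
  name i = inject≤ i k<n

  toℕ-named : ∀ {p i} → p ≡ name i → toℕ p ≡ toℕ i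
  toℕ-named {i = i} refl = toℕ-inject≤ i k<n

  named-or-leaf : ∀ (p : Fin n) → (∃ λ i → p ≡ name i) ⊎ (∃ λ t → toℕ p ≡ suc k + t)
  named-or-leaf p with toℕ p Data.Nat.<? suc k
  ... | yes p<1+k = inj₁ (fromℕ< p<1+k , toℕ-injective (sym (trans (toℕ-named refl) (toℕ-fromℕ< p<1+k))))
  ... | no  p≮1+k with m≤n⇒∃[o]m+o≡n (≮⇒≥ p≮1+k)
  ...   | t , e = inj₂ (t , sym e)

  recognise : (G : Graph n) (s : Fin (suc k) → Fin n) → Injective _≡_ _≡_ s →
              All (λ (i , j) → Adj G (s i) (s j)) edges →
              (∀ x → (∀ i → x ≢ s i) → Adj G (s zero) x) →
              degreeSum G ≤ degreeSum (mkGraph n b) → G ≅ mkGraph n b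
  recognise G s s-inj s-edges s-hub = ≅-fromEmbedding G (mkGraph n b) π
    (λ x y πx~πy → [ edge-back x y , Adj-sym G ∘ edge-back y x ] (mkGraph-Adj b πx~πy))
    where
    extension : ∃ λ (π : Permutation n n) → ∀ i → π ⟨$⟩ʳ s i ≡ name i
    extension = extendToPermutation s name s-inj (λ {i} {j} → inject≤-injective k<n k<n i j)
    π : Permutation n n
    π = proj₁ extension
    π-s : ∀ i → π ⟨$⟩ʳ s i ≡ name i
    π-s = proj₂ extension

    named⇒s : ∀ {x i} → π ⟨$⟩ʳ x ≡ name i → x ≡ s i
    named⇒s πx≡ = ⟨$⟩ʳ-injective π (trans πx≡ (sym (π-s _)))

    leaf⇒unnamed : ∀ {x t} → toℕ (π ⟨$⟩ʳ x) ≡ suc k + t → ∀ i → x ≢ s i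
    leaf⇒unnamed {t = t} e i refl = <⇒≱ (subst (_< suc k) (sym (toℕ-named (π-s i))) (toℕ<n i))
                                        (subst (suc k ≤_) (sym e) (m≤m+n (suc k) t))

    hub-back : ∀ {x y i t} → π ⟨$⟩ʳ x ≡ name i → toℕ (π ⟨$⟩ʳ y) ≡ suc k + t →
               b (toℕ i) (suc k + t) ∨ b (suc k + t) (toℕ i) ≡ true → Adj G x y
    hub-back {i = i} ex ey bit with hub-edges i _ bit
    ... | refl = subst (λ x → Adj G x _) (sym (named⇒s ex)) (s-hub _ (leaf⇒unnamed ey))

    edge-back : ∀ x y → b (toℕ (π ⟨$⟩ʳ x)) (toℕ (π ⟨$⟩ʳ y)) ≡ true → Adj G x y
    edge-back x y bxy with named-or-leaf (π ⟨$⟩ʳ x) | named-or-leaf (π ⟨$⟩ʳ y)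
    ... | inj₁ (i , ex) | inj₁ (j , ey) = subst₂ (Adj G) (sym (named⇒s ex)) (sym (named⇒s ey))
      (All.lookup s-edges (named-edges i j (subst₂ (λ p q → b p q ≡ true) (toℕ-named ex) (toℕ-named ey) bxy)))
    ... | inj₁ (i , ex) | inj₂ (t , ey) = hub-back ex ey
      (∨-trueˡ (subst₂ (λ p q → b p q ≡ true) (toℕ-named ex) ey bxy))
    ... | inj₂ (t , ex) | inj₁ (j , ey) = Adj-sym G (hub-back ey ex
      (∨-trueʳ (b (toℕ j) (suc k + t)) (subst₂ (λ p q → b p q ≡ true) ex (toℕ-named ey) bxy)))
    ... | inj₂ (s′ , ex) | inj₂ (t , ey) = ⊥-elim (no-leaf-edges s′ t (subst₂ (λ p q → b p q ≡ true) ex ey bxy))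

_∈?_ : ∀ {k} (e : Fin k × Fin k) es → Dec (e ∈ es)
_∈?_ {k} = DecMembership._∈?_ (≡-dec (_≟_ {k}) _≟_)

-- The finite checks below are discharged by evaluation: the leaf index t stays a variable.
decide-named : ∀ {k} (b : ℕ → ℕ → Bool) (edges : List (Fin k × Fin k)) →
  {True (all? λ i → all? λ j → (b (toℕ i) (toℕ j) Bool.≟ true) →-dec ((i , j) ∈? edges))} →
  ∀ i j → b (toℕ i) (toℕ j) ≡ true → (i , j) ∈ edges
decide-named b edges {checked} = toWitness checked

decide-hub : ∀ {k} (b : ℕ → ℕ → Bool) →
  (∀ t → True (all? λ (i : Fin (suc k)) → (b (toℕ i) (suc k + t) ∨ b (suc k + t) (toℕ i) Bool.≟ true) →-dec (i ≟ zero))) →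
  ∀ i t → b (toℕ i) (suc k + t) ∨ b (suc k + t) (toℕ i) ≡ true → i ≡ zero
decide-hub b checked i t = toWitness (checked t) i

leaf : ∀ {m} → Fin m → Fin (6 + m)
leaf y = suc (suc (suc (suc (suc (suc y)))))

record DegreeProfile {m} (H : Graph (6 + m)) (d₀ d₁ d₂ d₃ d₄ d₅ : ℕ) : Set where
  field
    deg₀ : degree H 0F ≡ d₀
    deg₁ : degree H 1F ≡ d₁
    deg₂ : degree H 2F ≡ d₂
    deg₃ : degree H 3F ≡ d₃
    deg₄ : degree H 4F ≡ d₄
    deg₅ : degree H 5F ≡ d₅
    deg-leaf : ∀ y → degree H (leaf y) ≡ 1

sum-profile : ∀ {m} {H : Graph (6 + m)} {d₀ d₁ d₂ d₃ d₄ d₅} → DegreeProfile H d₀ d₁ d₂ d₃ d₄ d₅ →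
  (f : ℕ → ℕ) → sum (f ∘ degree H) ≡ f d₀ + (f d₁ + (f d₂ + (f d₃ + (f d₄ + (f d₅ + m * f 1)))))
sum-profile {m} P f = cong₇ (cong f deg₀) (cong f deg₁) (cong f deg₂) (cong f deg₃) (cong f deg₄) (cong f deg₅)
  (trans (sum-cong-≗ (cong f ∘ deg-leaf)) (sum-const {m} (f 1)))
  where
  open DegreeProfile P
  cong₇ : ∀ {a₀ a₁ a₂ a₃ a₄ a₅ a₆ b₀ b₁ b₂ b₃ b₄ b₅ b₆ : ℕ} → a₀ ≡ b₀ → a₁ ≡ b₁ → a₂ ≡ b₂ → a₃ ≡ b₃ →
          a₄ ≡ b₄ → a₅ ≡ b₅ → a₆ ≡ b₆ →
          a₀ + (a₁ + (a₂ + (a₃ + (a₄ + (a₅ + a₆))))) ≡ b₀ + (b₁ + (b₂ + (b₃ + (b₄ + (b₅ + b₆)))))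
  cong₇ refl refl refl refl refl refl refl = refl

no-leaf-neighbours : ∀ m → sum {m} (λ _ → 0) ≡ 0
no-leaf-neighbours m = sum-zeros {m} λ _ → refl

Findex-profile : ∀ {m} {H : Graph (6 + m)} {d₀ d₁ d₂ d₃ d₄ d₅} → DegreeProfile H d₀ d₁ d₂ d₃ d₄ d₅ →
  Findex H ≡ d₀ ^ 3 + (d₁ ^ 3 + (d₂ ^ 3 + (d₃ ^ 3 + (d₄ ^ 3 + (d₅ ^ 3 + m * 1)))))
Findex-profile {H = H} P = trans (Findex≡ H) (sum-profile P (_^ 3))

degreeSum-profile : ∀ {m} {H : Graph (6 + m)} {d₀ d₁ d₂ d₃ d₄ d₅} → DegreeProfile H d₀ d₁ d₂ d₃ d₄ d₅ →
  d₀ + (d₁ + (d₂ + (d₃ + (d₄ + (d₅ + m * 1))))) ≡ 2 * (6 + m) → degreeSum H ≡ 2 * (6 + m)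
degreeSum-profile P total = trans (sum-profile P (λ d → d)) total

-- Each rule repeats the one in the definition of the graph, so that mkGraph (6 + m) rule is that graph.
module G41-facts (m : ℕ) where

  rule : ℕ → ℕ → Bool
  rule i j = cyc i j ∨ ((i ≡ᵇ 0) ∧ (4 ≤ᵇ j))

  profile : DegreeProfile (G41 (6 + m)) (4 + m) 2 2 2 1 1
  profile = record
    { deg₀ = cong (4 +_) (sum-ones m) ; deg₁ = cong (2 +_) (no-leaf-neighbours m)
    ; deg₂ = cong (2 +_) (no-leaf-neighbours m) ; deg₃ = cong (2 +_) (no-leaf-neighbours m)
    ; deg₄ = cong (1 +_) (no-leaf-neighbours m) ; deg₅ = cong (1 +_) (no-leaf-neighbours m)
    ; deg-leaf = λ _ → cong (1 +_) (no-leaf-neighbours m) }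

  Findex-value : Findex (G41 (6 + m)) ≡ (4 + m) ^ 3 + (26 + m)
  Findex-value = trans (Findex-profile profile) (cong (λ t → (4 + m) ^ 3 + (26 + t)) (*-identityʳ m))

  open Recognition {6 + m} {3} (s≤s (s≤s (s≤s (s≤s z≤n)))) rule
    ((0F , 1F) ∷ (1F , 2F) ∷ (2F , 3F) ∷ (3F , 0F) ∷ [])
    (decide-named rule _) (decide-hub rule λ _ → _) (λ _ _ ())

  recognise41 : ∀ (G : Graph (6 + m)) {a b c d} → Square G a b c d →
    (∀ x → x ≢ a → x ≢ c → Adj G a x) → degreeSum G ≤ 2 * (6 + m) → G ≅ G41 (6 + m)
  recognise41 G {a} {b} {c} {d} sq a~ ΣG≤ = recognise G (lookup (a ∷ b ∷ c ∷ d ∷ []))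
    (λ {i} {j} → lookup-injective ((a≢b ∷ a≢c ∷ a≢d ∷ []) ∷ (b≢c ∷ b≢d ∷ []) ∷ (c≢d ∷ []) ∷ [] ∷ []) i j)
    (a~b ∷ b~c ∷ c~d ∷ d~a ∷ [])
    (λ x x∉ → a~ x (x∉ 0F) (x∉ 2F))
    (subst (degreeSum G ≤_) (sym (degreeSum-profile profile (edge-total m))) ΣG≤)
    where
    open Square sq
    edge-total : ∀ m → 4 + m + (2 + (2 + (2 + (1 + (1 + m * 1))))) ≡ 2 * (6 + m)
    edge-total = solve-∀

module G42-facts (m : ℕ) where

  rule : ℕ → ℕ → Bool
  rule i j = cyc i j ∨ ((i ≡ᵇ 1) ∧ (j ≡ᵇ 4)) ∨ ((i ≡ᵇ 0) ∧ (5 ≤ᵇ j))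

  profile : DegreeProfile (G42 (6 + m)) (3 + m) 3 2 2 1 1
  profile = record
    { deg₀ = cong (3 +_) (sum-ones m) ; deg₁ = cong (3 +_) (no-leaf-neighbours m)
    ; deg₂ = cong (2 +_) (no-leaf-neighbours m) ; deg₃ = cong (2 +_) (no-leaf-neighbours m)
    ; deg₄ = cong (1 +_) (no-leaf-neighbours m) ; deg₅ = cong (1 +_) (no-leaf-neighbours m)
    ; deg-leaf = λ _ → cong (1 +_) (no-leaf-neighbours m) }

  Findex-value : Findex (G42 (6 + m)) ≡ (3 + m) ^ 3 + (45 + m)
  Findex-value = trans (Findex-profile profile) (cong (λ t → (3 + m) ^ 3 + (45 + t)) (*-identityʳ m))

  open Recognition {6 + m} {4} (s≤s (s≤s (s≤s (s≤s (s≤s z≤n))))) rule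
    ((0F , 1F) ∷ (1F , 2F) ∷ (2F , 3F) ∷ (3F , 0F) ∷ (1F , 4F) ∷ [])
    (decide-named rule _) (decide-hub rule λ _ → _) (λ _ _ ())

  recognise42 : ∀ (G : Graph (6 + m)) {a b c d w} → Square G a b c d →
    a ≢ w → b ≢ w → c ≢ w → d ≢ w → Adj G b w →
    (∀ x → x ≢ a → x ≢ c → x ≢ w → Adj G a x) → degreeSum G ≤ 2 * (6 + m) → G ≅ G42 (6 + m)
  recognise42 G {a} {b} {c} {d} {w} sq a≢w b≢w c≢w d≢w b~w a~ ΣG≤ = recognise G (lookup (a ∷ b ∷ c ∷ d ∷ w ∷ []))
    (λ {i} {j} → lookup-injective
      ((a≢b ∷ a≢c ∷ a≢d ∷ a≢w ∷ []) ∷ (b≢c ∷ b≢d ∷ b≢w ∷ []) ∷ (c≢d ∷ c≢w ∷ []) ∷ (d≢w ∷ []) ∷ [] ∷ []) i j)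
    (a~b ∷ b~c ∷ c~d ∷ d~a ∷ b~w ∷ [])
    (λ x x∉ → a~ x (x∉ 0F) (x∉ 2F) (x∉ 4F))
    (subst (degreeSum G ≤_) (sym (degreeSum-profile profile (edge-total m))) ΣG≤)
    where
    open Square sq
    edge-total : ∀ m → 3 + m + (3 + (2 + (2 + (1 + (1 + m * 1))))) ≡ 2 * (6 + m)
    edge-total = solve-∀

module G43-facts (m : ℕ) where

  rule : ℕ → ℕ → Bool
  rule i j = cyc i j ∨ ((i ≡ᵇ 2) ∧ (j ≡ᵇ 4)) ∨ ((i ≡ᵇ 0) ∧ (5 ≤ᵇ j))

  profile : DegreeProfile (G43 (6 + m)) (3 + m) 2 3 2 1 1
  profile = record
    { deg₀ = cong (3 +_) (sum-ones m) ; deg₁ = cong (2 +_) (no-leaf-neighbours m)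
    ; deg₂ = cong (3 +_) (no-leaf-neighbours m) ; deg₃ = cong (2 +_) (no-leaf-neighbours m)
    ; deg₄ = cong (1 +_) (no-leaf-neighbours m) ; deg₅ = cong (1 +_) (no-leaf-neighbours m)
    ; deg-leaf = λ _ → cong (1 +_) (no-leaf-neighbours m) }

  Findex-value : Findex (G43 (6 + m)) ≡ (3 + m) ^ 3 + (45 + m)
  Findex-value = trans (Findex-profile profile) (cong (λ t → (3 + m) ^ 3 + (45 + t)) (*-identityʳ m))

  open Recognition {6 + m} {4} (s≤s (s≤s (s≤s (s≤s (s≤s z≤n))))) rule
    ((0F , 1F) ∷ (1F , 2F) ∷ (2F , 3F) ∷ (3F , 0F) ∷ (2F , 4F) ∷ [])
    (decide-named rule _) (decide-hub rule λ _ → _) (λ _ _ ())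

  recognise43 : ∀ (G : Graph (6 + m)) {a b c d w} → Square G a b c d →
    a ≢ w → b ≢ w → c ≢ w → d ≢ w → Adj G c w →
    (∀ x → x ≢ a → x ≢ c → x ≢ w → Adj G a x) → degreeSum G ≤ 2 * (6 + m) → G ≅ G43 (6 + m)
  recognise43 G {a} {b} {c} {d} {w} sq a≢w b≢w c≢w d≢w c~w a~ ΣG≤ = recognise G (lookup (a ∷ b ∷ c ∷ d ∷ w ∷ []))
    (λ {i} {j} → lookup-injective
      ((a≢b ∷ a≢c ∷ a≢d ∷ a≢w ∷ []) ∷ (b≢c ∷ b≢d ∷ b≢w ∷ []) ∷ (c≢d ∷ c≢w ∷ []) ∷ (d≢w ∷ []) ∷ [] ∷ []) i j)
    (a~b ∷ b~c ∷ c~d ∷ d~a ∷ c~w ∷ [])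
    (λ x x∉ → a~ x (x∉ 0F) (x∉ 2F) (x∉ 4F))
    (subst (degreeSum G ≤_) (sym (degreeSum-profile profile (edge-total m))) ΣG≤)
    where
    open Square sq
    edge-total : ∀ m → 3 + m + (2 + (3 + (2 + (1 + (1 + m * 1))))) ≡ 2 * (6 + m)
    edge-total = solve-∀

module G41′-facts (m : ℕ) where

  rule : ℕ → ℕ → Bool
  rule i j = cyc i j ∨ ((i ≡ᵇ 5) ∧ (j ≡ᵇ 4)) ∨ ((i ≡ᵇ 0) ∧ (5 ≤ᵇ j))

  profile : DegreeProfile (G41' (6 + m)) (3 + m) 2 2 2 1 2
  profile = record
    { deg₀ = cong (3 +_) (sum-ones m) ; deg₁ = cong (2 +_) (no-leaf-neighbours m)
    ; deg₂ = cong (2 +_) (no-leaf-neighbours m) ; deg₃ = cong (2 +_) (no-leaf-neighbours m)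
    ; deg₄ = cong (1 +_) (no-leaf-neighbours m) ; deg₅ = cong (2 +_) (no-leaf-neighbours m)
    ; deg-leaf = λ _ → cong (1 +_) (no-leaf-neighbours m) }

  Findex-value : Findex (G41' (6 + m)) ≡ (3 + m) ^ 3 + (33 + m)
  Findex-value = trans (Findex-profile profile) (cong (λ t → (3 + m) ^ 3 + (33 + t)) (*-identityʳ m))

  open Recognition {6 + m} {5} (s≤s (s≤s (s≤s (s≤s (s≤s (s≤s z≤n)))))) rule
    ((0F , 1F) ∷ (1F , 2F) ∷ (2F , 3F) ∷ (3F , 0F) ∷ (5F , 4F) ∷ (0F , 5F) ∷ [])
    (decide-named rule _) (decide-hub rule λ _ → _) (λ _ _ ())

  recognise41′ : ∀ (G : Graph (6 + m)) {a b c d w y} → Square G a b c d →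
    a ≢ w → b ≢ w → c ≢ w → d ≢ w → a ≢ y → b ≢ y → c ≢ y → d ≢ y → w ≢ y → Adj G y w →
    (∀ x → x ≢ a → x ≢ c → x ≢ w → Adj G a x) → degreeSum G ≤ 2 * (6 + m) → G ≅ G41' (6 + m)
  recognise41′ G {a} {b} {c} {d} {w} {y} sq a≢w b≢w c≢w d≢w a≢y b≢y c≢y d≢y w≢y y~w a~ ΣG≤ =
    recognise G (lookup (a ∷ b ∷ c ∷ d ∷ w ∷ y ∷ []))
    (λ {i} {j} → lookup-injective ((a≢b ∷ a≢c ∷ a≢d ∷ a≢w ∷ a≢y ∷ []) ∷ (b≢c ∷ b≢d ∷ b≢w ∷ b≢y ∷ []) ∷
                                   (c≢d ∷ c≢w ∷ c≢y ∷ []) ∷ (d≢w ∷ d≢y ∷ []) ∷ (w≢y ∷ []) ∷ [] ∷ []) i j)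
    (a~b ∷ b~c ∷ c~d ∷ d~a ∷ y~w ∷ a~ y (≢-sym a≢y) (≢-sym c≢y) (≢-sym w≢y) ∷ [])
    (λ x x∉ → a~ x (x∉ 0F) (x∉ 2F) (x∉ 4F))
    (subst (degreeSum G ≤_) (sym (degreeSum-profile profile (edge-total m))) ΣG≤)
    where
    open Square sq
    edge-total : ∀ m → 3 + m + (2 + (2 + (2 + (1 + (2 + m * 1))))) ≡ 2 * (6 + m)
    edge-total = solve-∀

-- The numerical estimate

≤-by-gap : ∀ {a b d} → b ≡ a + d → a ≤ b
≤-by-gap {a} {d = d} b≡ = subst (a ≤_) (sym b≡) (m≤m+n a d)

-- (1 + x)³ = 1 + 7x + x(x + 4)(x - 1)
suc-cube≤ : ∀ M x → x ≤ M → suc x ^ 3 ≤ 1 + 7 * x + M * (M + 4) * (x ∸ 1)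
suc-cube≤ M zero    _       = s≤s z≤n
suc-cube≤ M (suc e) 1+e≤M = begin
  (2 + e) ^ 3                       ≡⟨ expand e ⟩
  8 + 7 * e + e * ((1 + e) * (5 + e)) ≤⟨ +-monoʳ-≤ (8 + 7 * e) (*-monoʳ-≤ e (*-mono-≤ 1+e≤M (+-monoʳ-≤ 4 1+e≤M))) ⟩
  8 + 7 * e + e * (M * (4 + M))     ≡⟨ regroup e M ⟩
  1 + 7 * suc e + M * (M + 4) * e   ∎
  where
  open ≤-Reasoning
  expand : ∀ e → (2 + e) * ((2 + e) * ((2 + e) * 1)) ≡ 8 + 7 * e + e * ((1 + e) * (5 + e))
  expand = solve-∀
  regroup : ∀ e M → 8 + 7 * e + e * (M * (4 + M)) ≡ 1 + 7 * suc e + M * (M + 4) * e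
  regroup = solve-∀

-- (a + k + 2)³ + a + k + 32 is F(G′₄,₁) on a + k + 5 vertices.
cube-estimate-large : ∀ j k → let a = k + 3 + j in
  (1 + a) ^ 3 + (a + 4 + k) + 7 * (5 + k) + (k + 3) * (k + 3 + 4) * (k + 2) < (a + k + 2) ^ 3 + a + k + 32
cube-estimate-large j k = ≤-by-gap (expand j k)
  where
  expand : ∀ j k → (k + 3 + j + k + 2) * ((k + 3 + j + k + 2) * ((k + 3 + j + k + 2) * 1)) + (k + 3 + j) + k + 32 ≡
    1 + ((1 + (k + 3 + j)) * ((1 + (k + 3 + j)) * ((1 + (k + 3 + j)) * 1)) + (k + 3 + j + 4 + k) + 7 * (5 + k) + (k + 3) * (k + 3 + 4) * (k + 2))
    + (11 + 54 * k + 36 * k * k + 6 * k * k * k + 27 * j + 36 * j * k + 9 * j * k * k + 3 * j * j + 3 * j * j * k)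
  expand = solve-∀

cube-estimate-small : ∀ a k → 1 ≤ a → a ≤ k + 3 →
  (1 + a) ^ 3 + (a + 4 + k) + 7 * (5 + k) + a * (a + 4) * (k + 2) < (a + k + 2) ^ 3 + a + k + 32
cube-estimate-small 1 k _ _ = ≤-by-gap (expand k)
  where
  expand : ∀ k → (1 + k + 2) * ((1 + k + 2) * ((1 + k + 2) * 1)) + 1 + k + 32 ≡
    1 + ((1 + 1) * ((1 + 1) * ((1 + 1) * 1)) + (1 + 4 + k) + 7 * (5 + k) + 1 * (1 + 4) * (k + 2)) + (1 + 15 * k + 9 * k * k + k * k * k)
  expand = solve-∀
cube-estimate-small 2 k _ _ = ≤-by-gap (expand k)
  where
  expand : ∀ k → (2 + k + 2) * ((2 + k + 2) * ((2 + k + 2) * 1)) + 2 + k + 32 ≡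
    1 + ((1 + 2) * ((1 + 2) * ((1 + 2) * 1)) + (2 + 4 + k) + 7 * (5 + k) + 2 * (2 + 4) * (k + 2)) + (5 + 29 * k + 12 * k * k + k * k * k)
  expand = solve-∀
cube-estimate-small (suc (suc (suc p))) k _ a≤k+3 with m≤n⇒∃[o]m+o≡n (+-cancelʳ-≤ 3 p k (subst (_≤ k + 3) (+-comm 3 p) a≤k+3))
... | q , refl = ≤-by-gap (expand p q)
  where
  expand : ∀ p q → (3 + p + (p + q) + 2) * ((3 + p + (p + q) + 2) * ((3 + p + (p + q) + 2) * 1)) + (3 + p) + (p + q) + 32 ≡
    1 + ((1 + (3 + p)) * ((1 + (3 + p)) * ((1 + (3 + p)) * 1)) + (3 + p + 4 + (p + q)) + 7 * (5 + (p + q)) + (3 + p) * (3 + p + 4) * ((p + q) + 2))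
    + (11 + 47 * q + 15 * q * q + q * q * q + 54 * p + 50 * p * q + 6 * p * q * q + 36 * p * p + 11 * p * p * q + 6 * p * p * p)
  expand = solve-∀

-- Used with x = degree − 1, on a graph with a + k + 5 vertices whose maximum degree a + 1 is attained at v.
module ExcessSequence {n} (x : Fin n → ℕ) (v : Fin n) {a k : ℕ}
  (n≡ : n ≡ a + (5 + k)) (xv≡a : x v ≡ a) (x≤a : ∀ u → x u ≤ a) (Σx≤n : sum x ≤ n) (1≤a : 1 ≤ a)
  (t : Fin 3 → Fin n) (t-injective : Injective _≡_ _≡_ t) (t≢v : ∀ j → t j ≢ v) (1≤x∘t : ∀ j → 1 ≤ x (t j)) where

  others : (Fin n → ℕ) → ℕ
  others f = sum (erase v f)

  others-x≤ : others x ≤ 5 + k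
  others-x≤ = +-cancelˡ-≤ a (others x) (5 + k)
    (subst₂ _≤_ (trans (sum-erase v x) (cong (_+ others x) xv≡a)) n≡ Σx≤n)

  others-pred≤ : others (λ u → x u ∸ 1) ≤ k + 2
  others-pred≤ = +-cancelʳ-≤ 3 _ (k + 2) (begin
    others (λ u → x u ∸ 1) + 3                              ≤⟨ +-monoʳ-≤ (others (λ u → x u ∸ 1)) three-positive ⟩
    others (λ u → x u ∸ 1) + others (λ u → positive (x u))  ≡⟨ sum-distrib-+ (erase v (λ u → x u ∸ 1)) (erase v (λ u → positive (x u))) ⟨
    sum (λ u → erase v (λ u → x u ∸ 1) u + erase v (λ u → positive (x u)) u) ≡⟨ sum-cong-≗ split-excess ⟩
    others x                                                ≤⟨ others-x≤ ⟩
    5 + k                                                   ≡⟨ trans (+-comm 5 k) (sym (+-assoc k 2 3)) ⟩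
    k + 2 + 3                                               ∎)
    where
    open ≤-Reasoning
    positive-1 : ∀ {y} → 1 ≤ x y → y ≢ v → erase v (λ u → positive (x u)) y ≡ 1
    positive-1 {y} 1≤xy y≢v with x y | erase-other (λ u → positive (x u)) y≢v
    ... | suc _ | e = e
    three-positive : 3 ≤ others (λ u → positive (x u))
    three-positive = subst (_≤ others (λ u → positive (x u)))
      (cong₂ _+_ (cong₂ _+_ (positive-1 (1≤x∘t 0F) (t≢v 0F)) (positive-1 (1≤x∘t 1F) (t≢v 1F))) (positive-1 (1≤x∘t 2F) (t≢v 2F)))
      (sum-≥-triple (erase v (λ u → positive (x u))) (λ e → case t-injective e of λ ()) (λ e → case t-injective e of λ ())
                                                      (λ e → case t-injective e of λ ()))
    split-excess : ∀ u → erase v (λ u → x u ∸ 1) u + erase v (λ u → positive (x u)) u ≡ erase v x u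
    split-excess u with u ≟ v | x u
    ... | yes _ | _     = refl
    ... | no _  | zero  = refl
    ... | no _  | suc e = +-comm e 1

  x≤k+3 : ∀ u → u ≢ v → x u ≤ k + 3
  x≤k+3 u u≢v = begin
    x u                         ≤⟨ m≤n+m∸n (x u) 1 ⟩
    1 + (x u ∸ 1)               ≤⟨ +-monoʳ-≤ 1 (subst (_≤ others (λ u → x u ∸ 1)) (erase-other (λ u → x u ∸ 1) u≢v)
                                                   (sum-≥-point u (erase v (λ u → x u ∸ 1)))) ⟩
    1 + others (λ u → x u ∸ 1)  ≤⟨ +-monoʳ-≤ 1 others-pred≤ ⟩
    1 + (k + 2)                 ≡⟨ trans (+-comm 1 (k + 2)) (+-assoc k 2 1) ⟩
    k + 3                       ∎
    where open ≤-Reasoning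

  others-ones : others (λ _ → 1) ≡ a + 4 + k
  others-ones = suc-injective (trans (sym (sum-erase v (λ _ → 1))) (trans (sum-ones n) (trans n≡ (regroup a k))))
    where
    regroup : ∀ a k → a + (5 + k) ≡ suc (a + 4 + k)
    regroup = solve-∀

  others-affine : ∀ L → sum (λ u → erase v (λ _ → 1) u + 7 * erase v x u + L * erase v (λ u → x u ∸ 1) u) ≡
                          others (λ _ → 1) + 7 * others x + L * others (λ u → x u ∸ 1)
  others-affine L = begin
    sum (λ u → erase v (λ _ → 1) u + 7 * erase v x u + L * erase v (λ u → x u ∸ 1) u)
      ≡⟨ sum-distrib-+ (λ u → erase v (λ _ → 1) u + 7 * erase v x u) (λ u → L * erase v (λ u → x u ∸ 1) u) ⟩
    sum (λ u → erase v (λ _ → 1) u + 7 * erase v x u) + sum (λ u → L * erase v (λ u → x u ∸ 1) u)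
      ≡⟨ cong₂ _+_ (sum-distrib-+ (erase v (λ _ → 1)) (λ u → 7 * erase v x u)) (sum-distribˡ-* L (erase v (λ u → x u ∸ 1))) ⟩
    others (λ _ → 1) + sum (λ u → 7 * erase v x u) + L * others (λ u → x u ∸ 1)
      ≡⟨ cong (λ t → others (λ _ → 1) + t + L * others (λ u → x u ∸ 1)) (sum-distribˡ-* 7 (erase v x)) ⟩
    others (λ _ → 1) + 7 * others x + L * others (λ u → x u ∸ 1) ∎
    where open ≡-Reasoning

  sum-cubes≤ : ∀ M → (∀ u → u ≢ v → x u ≤ M) →
               sum (λ u → suc (x u) ^ 3) ≤ (1 + a) ^ 3 + (a + 4 + k) + 7 * (5 + k) + M * (M + 4) * (k + 2)
  sum-cubes≤ M x≤M = begin
    sum (λ u → suc (x u) ^ 3)                        ≡⟨ sum-erase v (λ u → suc (x u) ^ 3) ⟩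
    suc (x v) ^ 3 + others (λ u → suc (x u) ^ 3)     ≡⟨ cong (λ y → suc y ^ 3 + others (λ u → suc (x u) ^ 3)) xv≡a ⟩
    (1 + a) ^ 3 + others (λ u → suc (x u) ^ 3)       ≤⟨ +-monoʳ-≤ ((1 + a) ^ 3) (sum-mono-≤ pointwise) ⟩
    (1 + a) ^ 3 + sum (λ u → erase v (λ _ → 1) u + 7 * erase v x u + L * erase v (λ u → x u ∸ 1) u)
                                                     ≡⟨ cong ((1 + a) ^ 3 +_) (others-affine L) ⟩
    (1 + a) ^ 3 + (others (λ _ → 1) + 7 * others x + L * others (λ u → x u ∸ 1))
                                                     ≤⟨ +-monoʳ-≤ ((1 + a) ^ 3) (+-mono-≤ (+-mono-≤ (≤-reflexive others-ones)
                                                          (*-monoʳ-≤ 7 others-x≤)) (*-monoʳ-≤ L others-pred≤)) ⟩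
    (1 + a) ^ 3 + (a + 4 + k + 7 * (5 + k) + L * (k + 2))
                                                     ≡⟨ regroup ((1 + a) ^ 3) (a + 4 + k) (7 * (5 + k)) (L * (k + 2)) ⟩
    (1 + a) ^ 3 + (a + 4 + k) + 7 * (5 + k) + L * (k + 2) ∎
    where
    open ≤-Reasoning
    L : ℕ
    L = M * (M + 4)
    pointwise : ∀ u → erase v (λ u → suc (x u) ^ 3) u ≤ erase v (λ _ → 1) u + 7 * erase v x u + L * erase v (λ u → x u ∸ 1) u
    pointwise u with u ≟ v
    ... | yes _   = z≤n
    ... | no u≢v = suc-cube≤ M (x u) (x≤M u u≢v)
    regroup : ∀ c s t w → c + (s + t + w) ≡ c + s + t + w
    regroup = solve-∀

  sum-cubes< : sum (λ u → suc (x u) ^ 3) < (a + k + 2) ^ 3 + a + k + 32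
  sum-cubes< with a ≤? k + 3
  ... | yes a≤k+3 = ≤-trans (s≤s (sum-cubes≤ a (λ u _ → x≤a u))) (cube-estimate-small a k 1≤a a≤k+3)
  ... | no  a≰k+3 with m≤n⇒∃[o]m+o≡n (≰⇒≥ a≰k+3)
  ...   | j , k+3+j≡a = ≤-trans (s≤s (sum-cubes≤ (k + 3) x≤k+3))
    (subst (λ a → (1 + a) ^ 3 + (a + 4 + k) + 7 * (5 + k) + (k + 3) * (k + 3 + 4) * (k + 2) < (a + k + 2) ^ 3 + a + k + 32)
           k+3+j≡a (cube-estimate-large j k))

-- A vertex of maximum degree

module MaximumDegree (m : ℕ) (G : Graph (6 + m)) (U : UnicyclicC4 G) where

  open UnicyclicC4Facts U

  degree≥1 : ∀ u → 1 ≤ degree G u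
  degree≥1 u = degree-≥1 G (proj₂ (neighbour (proj₁ U u (other u)) (other≢ u)))
    where
    other : Fin (6 + m) → Fin (6 + m)
    other zero    = 1F
    other (suc _) = 0F
    other≢ : ∀ u → u ≢ other u
    other≢ zero    ()
    other≢ (suc _) ()

  C-degree≥2 : ∀ j → 2 ≤ degree G (c j)
  C-degree≥2 0F = degree-≥2 G a~b (Adj-sym G d~a) (≢-sym b≢d) where open Square C-square
  C-degree≥2 1F = degree-≥2 G b~c (Adj-sym G a~b) a≢c where open Square C-square
  C-degree≥2 2F = degree-≥2 G c~d (Adj-sym G b~c) b≢d where open Square C-square
  C-degree≥2 3F = degree-≥2 G d~a (Adj-sym G c~d) (≢-sym a≢c) where open Square C-square

  C-avoiding : ∀ v → ∃ λ i → ∀ j → c (punchIn i j) ≢ v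
  C-avoiding v with any? (λ i → v ≟ c i)
  ... | yes (i , refl) = i , λ j → punchInᵢ≢i i j ∘ inj C
  ... | no  v∉C        = 0F , λ j e → v∉C (punchIn 0F j , sym e)

  -- kept opaque so that the maximum search is never unfolded during type checking
  opaque
    maximum-degree : ∃ λ v → ∀ u → degree G u ≤ degree G v
    maximum-degree = argmax (degree G)

  v : Fin (6 + m)
  v = proj₁ maximum-degree

  v-max : ∀ u → degree G u ≤ degree G v
  v-max = proj₂ maximum-degree

  excess : Fin (6 + m) → ℕ
  excess u = degree G u ∸ 1

  degree≡ : ∀ u → degree G u ≡ suc (excess u)
  degree≡ u = trans (sym (m∸n+n≡m (degree≥1 u))) (+-comm (excess u) 1)

  sum-excess≤ : sum excess ≤ 6 + m
  sum-excess≤ = +-cancelʳ-≤ (6 + m) (sum excess) (6 + m) (begin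
    sum excess + (6 + m)               ≡⟨ cong (sum excess +_) (sum-ones (6 + m)) ⟨
    sum excess + sum {6 + m} (λ _ → 1) ≡⟨ sum-distrib-+ excess (λ _ → 1) ⟨
    sum (λ u → excess u + 1)           ≡⟨ sum-cong-≗ (λ u → trans (+-comm (excess u) 1) (sym (degree≡ u))) ⟩
    degreeSum G                        ≤⟨ degreeSum≤2n G U ⟩
    2 * (6 + m)                        ≡⟨ cong (6 + m +_) (+-identityʳ (6 + m)) ⟩
    6 + m + (6 + m)                    ∎)
    where open ≤-Reasoning

  Findex<-when-small-maximum : degree G v + 4 ≤ 6 + m → Findex G < Findex (G41' (6 + m))
  Findex<-when-small-maximum Δ+4≤n with m≤n⇒∃[o]m+o≡n (subst (_≤ 6 + m) (cong (_+ 4) (degree≡ v)) Δ+4≤n)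
  ... | k , Δ+4+k≡n = subst₂ _<_ (sym Findex-excess) target≡
        (ExcessSequence.sum-cubes< excess v n≡ refl (λ u → ∸-monoˡ-≤ 1 (v-max u)) sum-excess≤
          (≤-pred (≤-trans (C-degree≥2 0F) (≤-trans (v-max (c 0F)) (≤-reflexive (degree≡ v)))))
          (c ∘ punchIn i) (λ e → punchIn-injective i _ _ (inj C e)) (proj₂ (C-avoiding v))
          (λ j → ≤-pred (subst (2 ≤_) (degree≡ _) (C-degree≥2 _))))
    where
    i = proj₁ (C-avoiding v)
    a = excess v
    n≡ : 6 + m ≡ a + (5 + k)
    n≡ = trans (sym Δ+4+k≡n) (regroup a k)
      where
      regroup : ∀ s t → suc s + 4 + t ≡ s + (5 + t)
      regroup = solve-∀
    a+k≡1+m : a + k ≡ 1 + m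
    a+k≡1+m = +-cancelˡ-≡ 5 (a + k) (1 + m) (trans (regroup a k) (sym n≡))
      where
      regroup : ∀ s t → 5 + (s + t) ≡ s + (5 + t)
      regroup = solve-∀
    Findex-excess : Findex G ≡ sum (λ u → suc (excess u) ^ 3)
    Findex-excess = trans (Findex≡ G) (sum-cong-≗ λ u → cong (_^ 3) (degree≡ u))
    target≡ : (a + k + 2) ^ 3 + a + k + 32 ≡ Findex (G41' (6 + m))
    target≡ = trans (by-sum a k) (trans (cong shape a+k≡1+m) (trans (at-1+m m) (sym (G41′-facts.Findex-value m))))
      where
      shape : ℕ → ℕ
      shape s = (s + 2) * ((s + 2) * ((s + 2) * 1)) + (s + 32)
      by-sum : ∀ s t → (s + t + 2) * ((s + t + 2) * ((s + t + 2) * 1)) + s + t + 32 ≡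
                       (s + t + 2) * ((s + t + 2) * ((s + t + 2) * 1)) + (s + t + 32)
      by-sum = solve-∀
      at-1+m : ∀ t → (1 + t + 2) * ((1 + t + 2) * ((1 + t + 2) * 1)) + (1 + t + 32) ≡
                     (3 + t) * ((3 + t) * ((3 + t) * 1)) + (33 + t)
      at-1+m = solve-∀

  nonNeighbour : Fin (6 + m) → ℕ
  nonNeighbour y = ind (not (adj G v y))

  degree+nonNeighbours : degree G v + sum (erase v nonNeighbour) ≡ 5 + m
  degree+nonNeighbours = suc-injective (begin
    suc (degree G v + sum (erase v nonNeighbour))    ≡⟨ +-suc (degree G v) _ ⟨
    degree G v + (1 + sum (erase v nonNeighbour))    ≡⟨ cong (λ b → degree G v + (ind (not b) + sum (erase v nonNeighbour))) (irrefl G v) ⟨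
    degree G v + (nonNeighbour v + sum (erase v nonNeighbour)) ≡⟨ cong (degree G v +_) (sum-erase v nonNeighbour) ⟨
    degree G v + sum nonNeighbour                    ≡⟨ sum-distrib-+ (λ y → ind (adj G v y)) nonNeighbour ⟨
    sum (λ y → ind (adj G v y) + nonNeighbour y)     ≡⟨ sum-cong-≗ (λ y → ind+ind-not (adj G v y)) ⟩
    sum {6 + m} (λ _ → 1)                            ≡⟨ sum-ones (6 + m) ⟩
    6 + m                                            ∎)
    where
    open ≡-Reasoning
    ind+ind-not : ∀ b → ind b + ind (not b) ≡ 1
    ind+ind-not true  = refl
    ind+ind-not false = refl

  adjacent-to-all-but-two : ¬ (degree G v + 4 ≤ 6 + m) →
    ∃₂ λ w₁ w₂ → ∀ y → y ≢ v → y ≢ w₁ → y ≢ w₂ → Adj G v y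
  adjacent-to-all-but-two Δ+4≰n = w₁ , w₂ , λ y y≢v y≢w₁ y≢w₂ →
    not-false (trans (sym (erase-other nonNeighbour y≢v)) (support y y≢w₁ y≢w₂))
    where
    few : sum (erase v nonNeighbour) ≤ 2
    few = +-cancelʳ-≤ 2 _ 2 (+-cancelˡ-≤ (degree G v) _ 4 (begin
      degree G v + (sum (erase v nonNeighbour) + 2) ≡⟨ +-assoc (degree G v) _ 2 ⟨
      degree G v + sum (erase v nonNeighbour) + 2   ≡⟨ cong (_+ 2) degree+nonNeighbours ⟩
      5 + m + 2                                     ≡⟨ +-comm (5 + m) 2 ⟩
      7 + m                                         ≤⟨ ≰⇒> Δ+4≰n ⟩
      degree G v + 4                                ∎))
      where open ≤-Reasoning
    exceptions = sum≤2⇒support v (erase v nonNeighbour) few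
    w₁ w₂ : Fin (6 + m)
    w₁ = proj₁ exceptions
    w₂ = proj₁ (proj₂ exceptions)
    support : ∀ y → y ≢ w₁ → y ≢ w₂ → erase v nonNeighbour y ≡ 0
    support = proj₂ (proj₂ exceptions)
    not-false : ∀ {b} → ind (not b) ≡ 0 → b ≡ true
    not-false {true} _ = refl

  square-at : ∀ j → ∃ λ a → ∃₂ λ z b → Square G (c j) a z b
  square-at 0F = _ , _ , _ , C-square
  square-at 1F = _ , _ , _ , Square-rotate C-square
  square-at 2F = _ , _ , _ , Square-rotate (Square-rotate C-square)
  square-at 3F = _ , _ , _ , Square-rotate (Square-rotate (Square-rotate C-square))

  Extremal : Set
  Extremal = G ≅ G41 (6 + m) ⊎ G ≅ G42 (6 + m) ⊎ G ≅ G43 (6 + m) ⊎ G ≅ G41' (6 + m)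

  pendant-shape : ∀ {a z b w} → Square G v a z b → (∀ y → y ≢ v → y ≢ z → y ≢ w → Adj G v y) →
                  w ≢ v → w ≢ z → ¬ Adj G v w → Extremal
  pendant-shape {a} {z} {b} {w} sq v~ w≢v w≢z v≁w = attach (degree-≥1⇒neighbour G (degree≥1 w))
    where
    open Square sq
    w≢a : w ≢ a
    w≢a refl = v≁w a~b
    w≢b : w ≢ b
    w≢b refl = v≁w (Adj-sym G d~a)
    attach : (∃ λ y → Adj G w y) → Extremal
    attach (y , w~y) with y ≟ z | y ≟ a | y ≟ b
    ... | yes refl | _ | _ = inj₂ (inj₂ (inj₁ (G43-facts.recognise43 m G sq
          (≢-sym w≢v) (≢-sym w≢a) (≢-sym w≢z) (≢-sym w≢b) (Adj-sym G w~y) v~ (degreeSum≤2n G U))))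
    ... | no _ | yes refl | _ = inj₂ (inj₁ (G42-facts.recognise42 m G sq
          (≢-sym w≢v) (≢-sym w≢a) (≢-sym w≢z) (≢-sym w≢b) (Adj-sym G w~y) v~ (degreeSum≤2n G U)))
    ... | no _ | no _ | yes refl = inj₂ (inj₁ (G42-facts.recognise42 m G (Square-reflect sq)
          (≢-sym w≢v) (≢-sym w≢b) (≢-sym w≢z) (≢-sym w≢a) (Adj-sym G w~y) v~ (degreeSum≤2n G U)))
    ... | no y≢z | no y≢a | no y≢b = inj₂ (inj₂ (inj₂ (G41′-facts.recognise41′ m G sq
          (≢-sym w≢v) (≢-sym w≢a) (≢-sym w≢z) (≢-sym w≢b) (≢-sym y≢v) (≢-sym y≢a) (≢-sym y≢z) (≢-sym y≢b)
          (Adj⇒≢ G w~y) (Adj-sym G w~y) v~ (degreeSum≤2n G U))))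
      where
      y≢v : y ≢ v
      y≢v refl = v≁w (Adj-sym G w~y)

  G41-shape : ∀ {a z b w} → Square G v a z b → (∀ y → y ≢ v → y ≢ z → y ≢ w → Adj G v y) →
              (∀ {y} → y ≡ w → y ≢ v → y ≢ z → Adj G v y) → Extremal
  G41-shape {z = z} {w = w} sq v~ v~w = inj₁ (G41-facts.recognise41 m G sq v~all (degreeSum≤2n G U))
    where
    v~all : ∀ y → y ≢ v → y ≢ z → Adj G v y
    v~all y y≢v y≢z with y ≟ w
    ... | yes y≡w = v~w y≡w y≢v y≢z
    ... | no y≢w  = v~ y y≢v y≢z y≢w

  extremal-shape : ∀ {a z b w} → Square G v a z b → (∀ y → y ≢ v → y ≢ z → y ≢ w → Adj G v y) → Extremal
  extremal-shape {z = z} {w = w} sq v~ with w ≟ v | w ≟ z | adj G v w Bool.≟ true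
  ... | yes w≡v | _       | _       = G41-shape sq v~ λ y≡w y≢v _ → ⊥-elim (y≢v (trans y≡w w≡v))
  ... | no _    | yes w≡z | _       = G41-shape sq v~ λ y≡w _ y≢z → ⊥-elim (y≢z (trans y≡w w≡z))
  ... | no _    | no _    | yes v~w = G41-shape sq v~ λ { refl _ _ → v~w }
  ... | no w≢v  | no w≢z  | no v≁w  = pendant-shape sq v~ w≢v w≢z v≁w
  module _ {w₁ w₂ : Fin (6 + m)} (v~ : ∀ y → y ≢ v → y ≢ w₁ → y ≢ w₂ → Adj G v y) where

    -- a vertex off C adjacent to two consecutive cycle vertices closes a triangle, to two opposite ones a second square
    v-onC : ∃ λ j → v ≡ c j
    v-onC with any? (λ j → v ≟ c j)
    ... | yes onC = onC
    ... | no  offC = ⊥-elim (cases (v~? 0F) (v~? 1F) (v~? 2F) (v~? 3F))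
      where
      open Square C-square
      v≢ : ∀ j → v ≢ c j
      v≢ j v≡cj = offC (j , v≡cj)
      v~? : ∀ j → Dec (Adj G v (c j))
      v~? j = adj G v (c j) Bool.≟ true
      inW : ∀ {j} → ¬ Adj G v (c j) → c j ≡ w₁ ⊎ c j ≡ w₂
      inW {j} v≁cj with c j ≟ w₁ | c j ≟ w₂
      ... | yes e | _     = inj₁ e
      ... | no _  | yes e = inj₂ e
      ... | no ≢w₁ | no ≢w₂ = ⊥-elim (v≁cj (v~ (c j) (≢-sym (v≢ j)) ≢w₁ ≢w₂))
      three-in-pair : ∀ {i j k} → ¬ Adj G v (c i) → ¬ Adj G v (c j) → ¬ Adj G v (c k) →
                      c i ≢ c j → c i ≢ c k → c j ≢ c k → ⊥
      three-in-pair ni nj nk i≢j i≢k j≢k with inW ni | inW nj | inW nk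
      ... | inj₁ refl | inj₁ e    | _         = i≢j (sym e)
      ... | inj₂ refl | inj₂ e    | _         = i≢j (sym e)
      ... | inj₁ refl | _         | inj₁ e    = i≢k (sym e)
      ... | inj₂ refl | _         | inj₂ e    = i≢k (sym e)
      ... | _         | inj₁ refl | inj₁ e    = j≢k (sym e)
      ... | _         | inj₂ refl | inj₂ e    = j≢k (sym e)
      triangle : ∀ {i j} → Adj G v (c i) → Adj G (c i) (c j) → Adj G v (c j) → c i ≢ c j → ⊥
      triangle {i} {j} v~ci ci~cj v~cj ci≢cj = no-triangle (v≢ i) (v≢ j) ci≢cj v~ci ci~cj (Adj-sym G v~cj)
      second-square : ∀ {i j k} → Adj G v (c i) → Adj G (c i) (c j) → Adj G (c j) (c k) → Adj G v (c k) →
                      c i ≢ c j → c i ≢ c k → c j ≢ c k → ⊥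
      second-square {i} {j} {k} v~ci ci~cj cj~ck v~ck i≢j i≢k j≢k with square-onC (record
        { a≢b = v≢ i ; a≢c = v≢ j ; a≢d = v≢ k ; b≢c = i≢j ; b≢d = i≢k ; c≢d = j≢k
        ; a~b = v~ci ; b~c = ci~cj ; c~d = cj~ck ; d~a = Adj-sym G v~ck })
      ... | j′ , v≡cj′ = v≢ j′ v≡cj′
      cases : Dec (Adj G v (c 0F)) → Dec (Adj G v (c 1F)) → Dec (Adj G v (c 2F)) → Dec (Adj G v (c 3F)) → ⊥
      cases (yes v~0) (yes v~1) _         _         = triangle v~0 a~b v~1 a≢b
      cases _         (yes v~1) (yes v~2) _         = triangle v~1 b~c v~2 b≢c
      cases _         _         (yes v~2) (yes v~3) = triangle v~2 c~d v~3 c≢d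
      cases (yes v~0) _         _         (yes v~3) = triangle v~3 d~a v~0 (≢-sym a≢d)
      cases (yes v~0) (no _)    (yes v~2) (no _)    = second-square v~0 a~b b~c v~2 a≢b a≢c b≢c
      cases (no _)    (yes v~1) (no _)    (yes v~3) = second-square v~1 b~c c~d v~3 b≢c b≢d c≢d
      cases (no n0)   (no n1)   (no n2)   _         = three-in-pair n0 n1 n2 a≢b a≢c b≢c
      cases (no n0)   (no n1)   _         (no n3)   = three-in-pair n0 n1 n3 a≢b a≢d b≢d
      cases (no n0)   _         (no n2)   (no n3)   = three-in-pair n0 n2 n3 a≢c a≢d c≢d
      cases _         (no n1)   (no n2)   (no n3)   = three-in-pair n1 n2 n3 b≢c b≢d c≢d

    square-at-v : ∃ λ a → ∃₂ λ z b → Square G v a z b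
    square-at-v = subst (λ x → ∃ λ a → ∃₂ λ z b → Square G x a z b) (sym (proj₂ v-onC)) (square-at (proj₁ v-onC))

    -- the corner opposite v is not adjacent to v, so it is one of the two exceptions
    extremal-around : ∀ {a z b} → Square G v a z b → Extremal
    extremal-around {a} {z} {b} sq with z ≟ w₁ | z ≟ w₂
    ... | yes refl | _        = extremal-shape sq (λ y y≢v y≢z y≢w₂ → v~ y y≢v y≢z y≢w₂)
    ... | no _     | yes refl = extremal-shape sq (λ y y≢v y≢z y≢w₁ → v~ y y≢v y≢w₁ y≢z)
    ... | no z≢w₁  | no z≢w₂  = ⊥-elim (no-triangle a≢b a≢c b≢c a~b b~c (Adj-sym G (v~ z (≢-sym a≢c) z≢w₁ z≢w₂)))
      where open Square sq

  extremal-when-large-maximum : ¬ (degree G v + 4 ≤ 6 + m) → Extremal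
  extremal-when-large-maximum Δ+4≰n =
    let _ , _ , v~ = adjacent-to-all-but-two Δ+4≰n in extremal-around v~ (proj₂ (proj₂ (proj₂ (square-at-v v~))))

  Findex<-or-extremal : Findex G < Findex (G41' (6 + m)) ⊎ Extremal
  Findex<-or-extremal with degree G v + 4 ≤? 6 + m
  ... | yes Δ+4≤n = inj₁ (Findex<-when-small-maximum Δ+4≤n)
  ... | no  Δ+4≰n = inj₂ (extremal-when-large-maximum Δ+4≰n)

Findex-G42<G41 : ∀ m → Findex (G42 (6 + m)) < Findex (G41 (6 + m))
Findex-G42<G41 m = subst₂ _<_ (sym (G42-facts.Findex-value m)) (sym (G41-facts.Findex-value m))
  (≤-by-gap (expand m))
  where
  expand : ∀ m → (4 + m) * ((4 + m) * ((4 + m) * 1)) + (26 + m) ≡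
                 1 + ((3 + m) * ((3 + m) * ((3 + m) * 1)) + (45 + m)) + (17 + 21 * m + 3 * m * m)
  expand = solve-∀

Findex-G42≡G43 : ∀ m → Findex (G42 (6 + m)) ≡ Findex (G43 (6 + m))
Findex-G42≡G43 m = trans (G42-facts.Findex-value m) (sym (G43-facts.Findex-value m))

Findex-G41′<G43 : ∀ m → Findex (G41' (6 + m)) < Findex (G43 (6 + m))
Findex-G41′<G43 m = subst₂ _<_ (sym (G41′-facts.Findex-value m)) (sym (G43-facts.Findex-value m))
  (≤-by-gap (expand m))
  where
  expand : ∀ m → (3 + m) * ((3 + m) * ((3 + m) * 1)) + (45 + m) ≡
                 1 + ((3 + m) * ((3 + m) * ((3 + m) * 1)) + (33 + m)) + 11
  expand = solve-∀

theorem11 : ∀ (n : ℕ) → 6 ≤ n →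
    (Findex (G41 n) > Findex (G42 n)) ×
    (Findex (G42 n) ≡ Findex (G43 n)) ×
    (Findex (G43 n) > Findex (G41' n)) ×
    (∀ (G : Graph n) → UnicyclicC4 G →
      ¬ (G ≅ G41 n) → ¬ (G ≅ G42 n) → ¬ (G ≅ G43 n) → ¬ (G ≅ G41' n) →
      Findex G < Findex (G41' n))
theorem11 n 6≤n with m≤n⇒∃[o]m+o≡n 6≤n
... | m , refl = Findex-G42<G41 m , Findex-G42≡G43 m , Findex-G41′<G43 m , below-G41′
  where
  below-G41′ : ∀ G → UnicyclicC4 G → ¬ (G ≅ G41 (6 + m)) → ¬ (G ≅ G42 (6 + m)) → ¬ (G ≅ G43 (6 + m)) →
               ¬ (G ≅ G41' (6 + m)) → Findex G < Findex (G41' (6 + m))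
  below-G41′ G U ≇41 ≇42 ≇43 ≇41′ with MaximumDegree.Findex<-or-extremal m G U
  ... | inj₁ smaller                    = smaller
  ... | inj₂ (inj₁ ≅41)                 = ⊥-elim (≇41 ≅41)
  ... | inj₂ (inj₂ (inj₁ ≅42))          = ⊥-elim (≇42 ≅42)
  ... | inj₂ (inj₂ (inj₂ (inj₁ ≅43)))   = ⊥-elim (≇43 ≅43)
  ... | inj₂ (inj₂ (inj₂ (inj₂ ≅41′)))  = ⊥-elim (≇41′ ≅41′)
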